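{- Let $a,b,d$ be three pairwise coprime positive integers and let $m$ be an integer with $b\equiv am\pmod d$. Let $\alpha=\{m/d\}$, $\beta=\{(b-1)/d\}$, $\nu=d\{(a-1)/d\}$ and $C(\alpha,\beta,\nu)=\#\{k\in\{0,\dots,\nu\}: \{k\alpha\}\leqslant\beta\}$. Then $$g\Big(\frac{\langle a,b\rangle}{d}\Big)=\frac{g(\langle a,b\rangle)}{d}+\frac12\big[C(\alpha,\beta,\nu)-1-\beta\nu\big].$$ In particular, if $a\equiv1\pmod d$ or $b\equiv1\pmod d$, then $g(\langle a,b\rangle/d)=\frac{g(\langle a,b\rangle)}{d}=\frac{(a-1)(b-1)}{2d}$.
   Context: $\langle a,b\rangle=\{xa+yb:x,y\in\mathbb{N}\}$; for a numerical semigroup $S$ and positive integer $d$, $S/d=\{x\in\mathbb{N}:dx\in S\}$; $g(S)=\#(\mathbb{N}\setminus S)$ is the genus; $\{x\}$ denotes the fractional part of $x$. -}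

module Defs where

open import Data.Nat as ℕ using (ℕ; zero; suc; _*_; _+_)
open import Data.Integer as ℤ using (ℤ; +_)
open import Data.Rational as ℚ using (ℚ; _/_; _-_)
open import Data.Rational.Properties using (_≤?_)
open import Data.List using (List; length; filter; upTo)
open import Data.List.Relation.Unary.Unique.Propositional using (Unique)
open import Data.List.Membership.Propositional using (_∈_)
open import Data.Product using (Σ; ∃; _×_)
open import Function.Bundles using (_⇔_)
open import Relation.Binary.PropositionalEquality using (_≡_)
open import Relation.Nullary using (¬_)

⟨_,_⟩ : ℕ → ℕ → ℕ → Set
⟨ a , b ⟩ n = ∃ λ x → ∃ λ y → x * a + y * b ≡ n

_/ˢ_ : (ℕ → Set) → ℕ → ℕ → Set
(S /ˢ d) x = S (d * x)

IsGenus : (ℕ → Set) → ℕ → Set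
IsGenus S g = Σ (List ℕ) λ l → Unique l × (∀ n → (n ∈ l) ⇔ (¬ S n)) × length l ≡ g

-- fractional part {x} = x - ⌊x⌋ (standard; stdlib's fracPart uses truncation)
frac : ℚ → ℚ
frac x = x - (ℚ.floor x / 1)

C : ℚ → ℚ → ℕ → ℕ
C α β ν = length (filter (λ k → frac ((+ k / 1) ℚ.* α) ≤? β) (upTo (suc ν)))

{-# OPTIONS --safe #-}
-- Every n ∉ ⟨a,b⟩ is uniquely n = p a − q b with 0 ≤ p < b and q > 0, so x is a gap of ⟨a,b⟩/d
-- exactly when d x = p a − q b for such a pair; the genus g of ⟨a,b⟩/d therefore counts the pairs
-- (p,q) ∈ [1,b) × [1,a) with q b < p a and p a ≡ q b (mod d).  The involution
-- (p,q) ↦ (b − p, a − q) preserves the congruence and swaps q b < p a with p a < q b, so 2 g is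
-- the number of pairs in [1,b) × [1,a) with p ≡ q m (mod d).  Counting these residue classes
-- row by row gives 2 d g + d + ν (d β) = (a − 1)(b − 1) + d C(α,β,ν).  For d = 1 this is
-- Sylvester's 2 g(⟨a,b⟩) = (a − 1)(b − 1), and dividing by 2 d yields the formula.
module Submission where

module FiniteSums where

  open import Data.Nat
  open import Data.Nat.Properties
  open import Data.Nat.DivMod using (_%_; _/_; m%n<n; m<n⇒m%n≡m; [m+n]%n≡m%n; m≡m%n+[m/n]*n)
  open import Data.List using (List; []; _∷_; length; filter; upTo; _++_; [_]; map)
  open import Data.List.Properties using (upTo-∷ʳ; length-map; length-++; filter-++)
  open import Data.List.Relation.Unary.All as All using ()
  open import Data.List.Relation.Unary.All.Properties as All using ()
  open import Data.List.Relation.Unary.Any using (here; there)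
  open import Data.List.Relation.Unary.Unique.Propositional using (Unique; []; _∷_)
  open import Data.List.Relation.Unary.Unique.Propositional.Properties using (filter⁺; upTo⁺)
  open import Data.List.Membership.Propositional using (_∈_)
  open import Data.List.Membership.Propositional.Properties
    using (∈-map⁺; ∈-map⁻; ∈-filter⁺; ∈-filter⁻; ∈-upTo⁺; ∈-upTo⁻)
  open import Data.List.Membership.Propositional.Properties.WithK using (unique∧set⇒bag)
  open import Data.List.Relation.Binary.BagAndSetEquality using (∼bag⇒↭)
  open import Data.List.Relation.Binary.Permutation.Propositional.Properties using (↭-length)
  open import Data.Product using (∃; _×_; _,_; proj₁; proj₂)
  open import Data.Empty using (⊥-elim)
  open import Function.Bundles using (_⇔_; mk⇔)
  open import Relation.Binary.PropositionalEquality hiding ([_])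
  open import Relation.Binary.Definitions using (tri<; tri≈; tri>)
  open import Relation.Nullary using (Dec; yes; no; ¬_)
  open import Relation.Unary using (Pred; Decidable)
  open import Data.Nat.Solver using (module +-*-Solver)

  ∑< : ℕ → (ℕ → ℕ) → ℕ
  ∑< zero    f = 0
  ∑< (suc n) f = ∑< n f + f n

  syntax ∑< n (λ i → e) = ∑[ i < n ] e

  ∑-cong : ∀ n {f g : ℕ → ℕ} → (∀ i → i < n → f i ≡ g i) → ∑< n f ≡ ∑< n g
  ∑-cong zero    f≡g = refl
  ∑-cong (suc n) f≡g = cong₂ _+_ (∑-cong n (λ i i<n → f≡g i (m<n⇒m<1+n i<n))) (f≡g n (n<1+n n))

  ∑-distrib-+ : ∀ n (f g : ℕ → ℕ) → ∑[ i < n ] (f i + g i) ≡ ∑< n f + ∑< n g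
  ∑-distrib-+ zero    f g = refl
  ∑-distrib-+ (suc n) f g rewrite ∑-distrib-+ n f g = interchange (∑< n f) (∑< n g) (f n) (g n)
    where
    open +-*-Solver
    interchange : ∀ x y z w → x + y + (z + w) ≡ x + z + (y + w)
    interchange = solve 4 (λ x y z w → x :+ y :+ (z :+ w) := x :+ z :+ (y :+ w)) refl

  ∑-const : ∀ n c → ∑[ _ < n ] c ≡ n * c
  ∑-const zero    c = refl
  ∑-const (suc n) c rewrite ∑-const n c = +-comm (n * c) c

  ∑-suc : ∀ n (f : ℕ → ℕ) → ∑< (suc n) f ≡ f 0 + ∑[ i < n ] f (suc i)
  ∑-suc zero    f = +-comm 0 (f 0)
  ∑-suc (suc n) f rewrite ∑-suc n f = +-assoc (f 0) _ _

  ∑-+ : ∀ m n (f : ℕ → ℕ) → ∑< (m + n) f ≡ ∑< m f + ∑[ i < n ] f (m + i)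
  ∑-+ m zero    f rewrite +-identityʳ m = sym (+-identityʳ _)
  ∑-+ m (suc n) f rewrite +-suc m n | ∑-+ m n f = +-assoc (∑< m f) _ _

  ∑-reverse : ∀ n (f : ℕ → ℕ) → ∑< n f ≡ ∑[ i < n ] f (n ∸ suc i)
  ∑-reverse zero    f = refl
  ∑-reverse (suc n) f = begin
    ∑< n f + f n                          ≡⟨ +-comm (∑< n f) (f n) ⟩
    f n + ∑< n f                          ≡⟨ cong (f n +_) (∑-reverse n f) ⟩
    f n + ∑[ i < n ] f (n ∸ suc i)        ≡⟨ ∑-suc n (λ i → f (suc n ∸ suc i)) ⟨
    ∑[ i < suc n ] f (suc n ∸ suc i)      ∎
    where open ≡-Reasoning

  ∑-comm : ∀ n m (f : ℕ → ℕ → ℕ) → ∑[ i < n ] ∑[ j < m ] f i j ≡ ∑[ j < m ] ∑[ i < n ] f i j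
  ∑-comm zero    m f = sym (trans (∑-const m 0) (*-zeroʳ m))
  ∑-comm (suc n) m f rewrite ∑-comm n m f = sym (∑-distrib-+ m (λ j → ∑[ i < n ] f i j) (f n))

  ∑-periodic : ∀ d .{{_ : NonZero d}} (f : ℕ → ℕ) k s → s ≤ d →
    ∑[ x < k * d + s ] f (x % d) ≡ k * ∑< d f + ∑< s f
  ∑-periodic d f zero    s s≤d = ∑-cong s (λ i i<s → cong f (m<n⇒m%n≡m (<-≤-trans i<s s≤d)))
  ∑-periodic d f (suc k) s s≤d = begin
    ∑[ x < d + k * d + s ] f (x % d)
      ≡⟨ cong (λ n → ∑[ x < n ] f (x % d)) (+-assoc d (k * d) s) ⟩
    ∑[ x < d + (k * d + s) ] f (x % d)
      ≡⟨ ∑-+ d (k * d + s) _ ⟩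
    ∑[ x < d ] f (x % d) + ∑[ x < k * d + s ] f ((d + x) % d)
      ≡⟨ cong₂ _+_ (∑-cong d (λ i i<d → cong f (m<n⇒m%n≡m i<d)))
                   (∑-cong (k * d + s) (λ i _ → cong f (trans (cong (_% d) (+-comm d i)) ([m+n]%n≡m%n i d)))) ⟩
    ∑< d f + ∑[ x < k * d + s ] f (x % d)
      ≡⟨ cong (∑< d f +_) (∑-periodic d f k s s≤d) ⟩
    ∑< d f + (k * ∑< d f + ∑< s f)
      ≡⟨ +-assoc (∑< d f) _ _ ⟨
    ∑< d f + k * ∑< d f + ∑< s f ∎
    where open ≡-Reasoning

  𝟙 : ∀ {p} {P : Set p} → Dec P → ℕ
  𝟙 (yes _) = 1
  𝟙 (no  _) = 0

  𝟙-yes : ∀ {p} {P : Set p} (P? : Dec P) → P → 𝟙 P? ≡ 1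
  𝟙-yes (yes _) _ = refl
  𝟙-yes (no ¬p) p = ⊥-elim (¬p p)

  𝟙-no : ∀ {p} {P : Set p} (P? : Dec P) → ¬ P → 𝟙 P? ≡ 0
  𝟙-no (yes p) ¬p = ⊥-elim (¬p p)
  𝟙-no (no _)  _  = refl

  𝟙-cong : ∀ {p q} {P : Set p} {Q : Set q} (P? : Dec P) (Q? : Dec Q) → (P → Q) → (Q → P) → 𝟙 P? ≡ 𝟙 Q?
  𝟙-cong (yes _) (yes _) _ _ = refl
  𝟙-cong (yes p) (no ¬q) f _ = ⊥-elim (¬q (f p))
  𝟙-cong (no ¬p) (yes q) _ g = ⊥-elim (¬p (g q))
  𝟙-cong (no _)  (no _)  _ _ = refl

  ∑𝟙-≡ : ∀ r n → ∑[ x < n ] 𝟙 (x ≟ r) ≡ 𝟙 (r <? n)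
  ∑𝟙-≡ r zero = sym (𝟙-no (r <? 0) n≮0)
  ∑𝟙-≡ r (suc n) rewrite ∑𝟙-≡ r n with <-cmp r n
  ... | tri< r<n _ _ = trans (cong₂ _+_ (𝟙-yes (r <? n) r<n) (𝟙-no (n ≟ r) (λ n≡r → <-irrefl (sym n≡r) r<n)))
                             (sym (𝟙-yes (r <? suc n) (m<n⇒m<1+n r<n)))
  ... | tri≈ _ refl _ = trans (cong₂ _+_ (𝟙-no (r <? r) (<-irrefl refl)) (𝟙-yes (r ≟ r) refl))
                             (sym (𝟙-yes (r <? suc r) (n<1+n r)))
  ... | tri> _ _ n<r = trans (cong₂ _+_ (𝟙-no (r <? n) (<-asym n<r)) (𝟙-no (n ≟ r) (λ n≡r → <-irrefl n≡r n<r)))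
                             (sym (𝟙-no (r <? suc n) (λ r<1+n → <-irrefl refl (<-≤-trans n<r (≤-pred r<1+n)))))

  ∑𝟙-≤ : ∀ r n → ∑[ x < n ] 𝟙 (x ≤? r) ≡ n ⊓ suc r
  ∑𝟙-≤ r zero = refl
  ∑𝟙-≤ r (suc n) rewrite ∑𝟙-≤ r n with n ≤? r
  ... | yes n≤r = trans (cong (_+ 1) (m≤n⇒m⊓n≡m (m≤n⇒m≤1+n n≤r)))
                        (trans (+-comm n 1) (sym (m≤n⇒m⊓n≡m (s≤s n≤r))))
  ... | no  n≰r = trans (+-identityʳ _)
                        (trans (m≥n⇒m⊓n≡n (≰⇒> n≰r)) (sym (m≥n⇒m⊓n≡n (m<n⇒m<1+n (≰⇒> n≰r)))))

  ∑𝟙-%≡ : ∀ d .{{_ : NonZero d}} r n → r < d →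
    ∑[ x < suc n ] 𝟙 (x % d ≟ r) ≡ n / d + 𝟙 (r ≤? n % d)
  ∑𝟙-%≡ d r n r<d = begin
    ∑[ x < suc n ] 𝟙 (x % d ≟ r)
      ≡⟨ cong (λ k → ∑[ x < k ] 𝟙 (x % d ≟ r)) suc-n≡ ⟩
    ∑[ x < n / d * d + suc (n % d) ] 𝟙 (x % d ≟ r)
      ≡⟨ ∑-periodic d (λ x → 𝟙 (x ≟ r)) (n / d) (suc (n % d)) (m%n<n n d) ⟩
    n / d * ∑[ x < d ] 𝟙 (x ≟ r) + ∑[ x < suc (n % d) ] 𝟙 (x ≟ r)
      ≡⟨ cong₂ _+_ (trans (cong (n / d *_) (trans (∑𝟙-≡ r d) (𝟙-yes (r <? d) r<d))) (*-identityʳ (n / d)))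
                   (trans (∑𝟙-≡ r (suc (n % d))) (𝟙-cong (r <? suc (n % d)) (r ≤? n % d) ≤-pred s≤s)) ⟩
    n / d + 𝟙 (r ≤? n % d) ∎
    where
    open ≡-Reasoning
    suc-n≡ : suc n ≡ n / d * d + suc (n % d)
    suc-n≡ = trans (cong suc (trans (m≡m%n+[m/n]*n n d) (+-comm (n % d) _))) (sym (+-suc _ (n % d)))

  length-unique-⇔ : ∀ {A : Set} {xs ys : List A} → Unique xs → Unique ys →
    (∀ z → (z ∈ xs) ⇔ (z ∈ ys)) → length xs ≡ length ys
  length-unique-⇔ uxs uys xs⇔ys = ↭-length (∼bag⇒↭ (unique∧set⇒bag uxs uys (λ {z} → xs⇔ys z)))

  unique-map⁺ : ∀ {A B : Set} (f : A → B) {xs : List A} →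
    (∀ {x y} → x ∈ xs → y ∈ xs → f x ≡ f y → x ≡ y) → Unique xs → Unique (map f xs)
  unique-map⁺ f {[]}     inj []         = []
  unique-map⁺ f {x ∷ xs} inj (x∉ ∷ uxs) =
    All.map⁺ (All.tabulate (λ y∈ fx≡fy → All.lookup x∉ y∈ (inj (here refl) (there y∈) fx≡fy)))
    ∷ unique-map⁺ f (λ x∈ y∈ → inj (there x∈) (there y∈)) uxs

  module _ {p} {P : Pred ℕ p} (P? : Decidable P) where

    length-filter-upTo : ∀ n → length (filter P? (upTo n)) ≡ ∑[ x < n ] 𝟙 (P? x)
    length-filter-upTo zero = refl
    length-filter-upTo (suc n) = begin
      length (filter P? (upTo (suc n)))                       ≡⟨ cong (λ l → length (filter P? l)) (upTo-∷ʳ n) ⟨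
      length (filter P? (upTo n ++ [ n ]))                    ≡⟨ cong length (filter-++ P? (upTo n) [ n ]) ⟩
      length (filter P? (upTo n) ++ filter P? [ n ])          ≡⟨ length-++ (filter P? (upTo n)) ⟩
      length (filter P? (upTo n)) + length (filter P? [ n ])  ≡⟨ cong₂ _+_ (length-filter-upTo n) length-filter-[ n ] ⟩
      ∑[ x < n ] 𝟙 (P? x) + 𝟙 (P? n)                          ∎
      where
      open ≡-Reasoning
      length-filter-[_] : ∀ y → length (filter P? [ y ]) ≡ 𝟙 (P? y)
      length-filter-[ y ] with P? y
      ... | yes _ = refl
      ... | no  _ = refl

  module _ {p q} {P : Pred ℕ p} {Q : Pred ℕ q} (P? : Decidable P) (Q? : Decidable Q) where

    ∑𝟙-bijection : ∀ M N (f : ℕ → ℕ) →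
      (∀ x → x < M → Q x → f x < N × P (f x)) →
      (∀ {x y} → x < M → y < M → Q x → Q y → f x ≡ f y → x ≡ y) →
      (∀ z → z < N → P z → ∃ λ x → x < M × Q x × f x ≡ z) →
      ∑[ x < M ] 𝟙 (Q? x) ≡ ∑[ z < N ] 𝟙 (P? z)
    ∑𝟙-bijection M N f into inj onto = begin
      ∑[ x < M ] 𝟙 (Q? x)                  ≡⟨ length-filter-upTo Q? M ⟨
      length (filter Q? (upTo M))          ≡⟨ length-map f (filter Q? (upTo M)) ⟨
      length (map f (filter Q? (upTo M)))  ≡⟨ length-unique-⇔ unique-image (filter⁺ P? (upTo⁺ N)) image⇔ ⟩
      length (filter P? (upTo N))          ≡⟨ length-filter-upTo P? N ⟩
      ∑[ z < N ] 𝟙 (P? z)                  ∎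
      where
      open ≡-Reasoning
      domain : ∀ {x} → x ∈ filter Q? (upTo M) → x < M × Q x
      domain x∈ with ∈-filter⁻ Q? x∈
      ... | x∈upTo , qx = ∈-upTo⁻ x∈upTo , qx
      unique-image : Unique (map f (filter Q? (upTo M)))
      unique-image = unique-map⁺ f
        (λ x∈ y∈ → inj (proj₁ (domain x∈)) (proj₁ (domain y∈)) (proj₂ (domain x∈)) (proj₂ (domain y∈)))
        (filter⁺ Q? (upTo⁺ M))
      image⇔ : ∀ z → (z ∈ map f (filter Q? (upTo M))) ⇔ (z ∈ filter P? (upTo N))
      image⇔ z = mk⇔ to from
        where
        to : z ∈ map f (filter Q? (upTo M)) → z ∈ filter P? (upTo N)
        to z∈ with ∈-map⁻ f z∈
        ... | x , x∈ , refl with into x (proj₁ (domain x∈)) (proj₂ (domain x∈))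
        ... | fx<N , pfx = ∈-filter⁺ P? (∈-upTo⁺ fx<N) pfx
        from : z ∈ filter P? (upTo N) → z ∈ map f (filter Q? (upTo M))
        from z∈ with ∈-filter⁻ P? z∈
        ... | z∈upTo , pz with onto z (∈-upTo⁻ z∈upTo) pz
        ... | x , x<M , qx , refl = ∈-map⁺ f (∈-filter⁺ Q? (∈-upTo⁺ x<M) qx)

module IntegerCongruence where

  open import Data.Nat as ℕ using (ℕ; zero; suc; NonZero)
  import Data.Nat.DivMod as ℕ
  import Data.Nat.Properties as ℕ
  open import Data.Nat.Coprimality as ℕC using (Coprime)
  import Data.Nat.GCD as ℕG
  import Data.Nat.Divisibility as ℕD
  open import Data.Integer as ℤ using (ℤ; +_; -[1+_]; _+_; _-_; _*_; -_; 0ℤ; 1ℤ)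
  open import Data.Integer.Properties
  open import Data.Integer.Divisibility.Signed
  import Data.Integer.Coprimality as ℤC
  open import Data.Integer.DivMod using (_%ℕ_; _/ℕ_; a≡a%ℕn+[a/ℕn]*n)
  open import Data.Integer.Solver using (module +-*-Solver)
  open import Data.Product using (∃; _,_)
  open import Data.Sum using (_⊎_; inj₁; inj₂)
  open import Relation.Binary.PropositionalEquality
  open import Relation.Nullary using (Dec; contradiction)
  open import Relation.Nullary.Decidable using (map′)
  open import Relation.Binary.Bundles using (Setoid)
  open import Level using (0ℓ)
  open +-*-Solver

  +[m*n]≡+n*+m : ∀ m n → + (m ℕ.* n) ≡ + n * + m
  +[m*n]≡+n*+m m n = trans (pos-* m n) (*-comm (+ m) (+ n))

  infix 4 _≡_mod_
  record _≡_mod_ (x y : ℤ) (n : ℕ) : Set where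
    constructor congruent
    field divides-diff : + n ∣ x - y
  open _≡_mod_ public

  mod-reflexive : ∀ {n x y} → x ≡ y → x ≡ y mod n
  mod-reflexive {x = x} refl = congruent (divides 0ℤ (+-inverseʳ x))

  mod-sym : ∀ {n x y} → x ≡ y mod n → y ≡ x mod n
  mod-sym {x = x} {y} (congruent n∣x-y) = congruent (subst (_ ∣_) (negate-diff x y) (∣m⇒∣-m n∣x-y))
    where
    negate-diff : ∀ x y → - (x - y) ≡ y - x
    negate-diff = solve 2 (λ x y → :- (x :- y) := y :- x) refl

  mod-trans : ∀ {n x y z} → x ≡ y mod n → y ≡ z mod n → x ≡ z mod n
  mod-trans {x = x} {y} {z} (congruent n∣x-y) (congruent n∣y-z) =
    congruent (subst (_ ∣_) (telescope x y z) (∣m∣n⇒∣m+n n∣x-y n∣y-z))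
    where
    telescope : ∀ x y z → (x - y) + (y - z) ≡ x - z
    telescope = solve 3 (λ x y z → (x :- y) :+ (y :- z) := x :- z) refl

  mod-*ˡ : ∀ {n x y} c → x ≡ y mod n → c * x ≡ c * y mod n
  mod-*ˡ {x = x} {y} c (congruent n∣x-y) = congruent (subst (_ ∣_) (*-distribˡ-- c x y) (∣n⇒∣m*n c n∣x-y))
    where
    *-distribˡ-- : ∀ c x y → c * (x - y) ≡ c * x - c * y
    *-distribˡ-- = solve 3 (λ c x y → c :* (x :- y) := c :* x :- c :* y) refl

  mod-*ʳ : ∀ {n x y} c → x ≡ y mod n → x * c ≡ y * c mod n
  mod-*ʳ {x = x} {y} c x≡y = subst₂ (_≡_mod _) (*-comm c x) (*-comm c y) (mod-*ˡ c x≡y)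

  mod-cancelˡ : ∀ {n x y} c → Coprime n c → + c * x ≡ + c * y mod n → x ≡ y mod n
  mod-cancelˡ {n} {x} {y} c n⊥c (congruent n∣cx-cy) =
    congruent (∣ᵤ⇒∣ (ℤC.coprime-divisor (+ n) (+ c) (x - y) n⊥c (∣⇒∣ᵤ (subst (_ ∣_) (factor (+ c) x y) n∣cx-cy))))
    where
    factor : ∀ c x y → c * x - c * y ≡ c * (x - y)
    factor = solve 3 (λ c x y → c :* x :- c :* y := c :* (x :- y)) refl

  mod-%ℕ : ∀ z n .{{_ : NonZero n}} → z ≡ + (z %ℕ n) mod n
  mod-%ℕ z n = congruent (divides (z /ℕ n) (remove-rem _ (z /ℕ n) (+ n) (a≡a%ℕn+[a/ℕn]*n z n)))
    where
    remove-rem : ∀ {z} r q m → z ≡ r + q * m → z - r ≡ q * m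
    remove-rem r q m refl = solve 3 (λ r q m → (r :+ q :* m) :- r := q :* m) refl r q m

  mod-<-injective : ∀ {n x y} → x ℕ.< n → y ℕ.< n → + x ≡ + y mod n → x ≡ y
  mod-<-injective {n} {x} {y} x<n y<n (congruent n∣x-y) =
    +-injective (i-j≡0⇒i≡j (+ x) (+ y) (∣i∣≡0⇒i≡0 (small-multiple (∣⇒∣ᵤ n∣x-y) ∣x-y∣<n)))
    where
    ∣x-y∣<n : ℤ.∣ + x - + y ∣ ℕ.< n
    ∣x-y∣<n = ℕ.≤-<-trans (ℕ.≤-reflexive (cong ℤ.∣_∣ (m-n≡m⊖n x y)))
                (ℕ.≤-<-trans (∣m⊝n∣≤m⊔n x y) (ℕ.⊔-lub x<n y<n))
    small-multiple : ∀ {k} → n ℕD.∣ k → k ℕ.< n → k ≡ 0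
    small-multiple {zero}  _   _   = refl
    small-multiple {suc k} n∣k k<n = contradiction n∣k (ℕD.>⇒∤ k<n)

  mod-inverse : ∀ {c n} → Coprime c n → ∃ λ u → u * + c ≡ 1ℤ mod n
  mod-inverse {c} {n} c⊥n with ℕC.coprime-Bézout c⊥n
  ... | ℕG.Bézout.+- x y 1+y*n≡x*c =
    + x , congruent (divides (+ y) (rearrange (+ x) (+ y) (+ c) (+ n) (lift 1+y*n≡x*c)))
    where
    rearrange : ∀ x y c n → x * c ≡ 1ℤ + y * n → x * c - 1ℤ ≡ y * n
    rearrange x y c n e = trans (cong (_- 1ℤ) e) (cancel-1 y n)
      where
      cancel-1 : ∀ y n → 1ℤ + y * n - 1ℤ ≡ y * n
      cancel-1 = solve 2 (λ y n → (con 1ℤ :+ y :* n) :- con 1ℤ := y :* n) refl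
    lift : 1 ℕ.+ y ℕ.* n ≡ x ℕ.* c → + x * + c ≡ 1ℤ + + y * + n
    lift e = trans (sym (pos-* x c)) (trans (cong +_ (sym e)) (trans (pos-+ 1 (y ℕ.* n)) (cong (_+_ 1ℤ) (pos-* y n))))
  ... | ℕG.Bézout.-+ x y 1+x*c≡y*n =
    - + x , congruent (divides (- + y) (rearrange (+ x) (+ y) (+ c) (+ n) (lift 1+x*c≡y*n)))
    where
    rearrange : ∀ x y c n → y * n ≡ 1ℤ + x * c → (- x) * c - 1ℤ ≡ (- y) * n
    rearrange x y c n e = trans (negate x c) (trans (cong -_ (sym e)) (neg-distribˡ-* y n))
      where
      negate : ∀ x c → (- x) * c - 1ℤ ≡ - (1ℤ + x * c)
      negate = solve 2 (λ x c → (:- x) :* c :- con 1ℤ := :- (con 1ℤ :+ x :* c)) refl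
    lift : 1 ℕ.+ x ℕ.* c ≡ y ℕ.* n → + y * + n ≡ 1ℤ + + x * + c
    lift e = trans (sym (pos-* y n)) (trans (cong +_ (sym e)) (trans (pos-+ 1 (x ℕ.* c)) (cong (_+_ 1ℤ) (pos-* x c))))

  mod-+* : ∀ x k n → + (x ℕ.+ k ℕ.* n) ≡ + x mod n
  mod-+* x k n = congruent (divides (+ k) (trans (cong (_- + x) (pos-+ x (k ℕ.* n))) (trans (cancel (+ x) (+ (k ℕ.* n))) (pos-* k n))))
    where
    cancel : ∀ x y → x + y - x ≡ y
    cancel = solve 2 (λ x y → x :+ y :- x := y) refl

  mod⇒+* : ∀ {x y n} → + x ≡ + y mod n → (∃ λ k → x ≡ y ℕ.+ k ℕ.* n) ⊎ (∃ λ k → y ≡ x ℕ.+ k ℕ.* n)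
  mod⇒+* {x} {y} {n} (congruent (divides (+ k) x-y≡kn)) = inj₁ (k , +-injective (begin
    + x                      ≡⟨ move (+ x) (+ y) x-y≡kn ⟩
    + y + + k * + n          ≡⟨ cong (_+_ (+ y)) (pos-* k n) ⟨
    + y + + (k ℕ.* n)        ≡⟨ pos-+ y (k ℕ.* n) ⟨
    + (y ℕ.+ k ℕ.* n)        ∎))
    where
    open ≡-Reasoning
    move : ∀ x y {z} → x - y ≡ z → x ≡ y + z
    move x y refl = solve 2 (λ x y → x := y :+ (x :- y)) refl x y
  mod⇒+* {x} {y} {n} (congruent (divides -[1+ k ] x-y≡kn)) = inj₂ (suc k , +-injective (begin
    + y                        ≡⟨ move (+ x) (+ y) (trans x-y≡kn (sym (neg-distribˡ-* (+ suc k) (+ n)))) ⟩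
    + x + + suc k * + n        ≡⟨ cong (_+_ (+ x)) (pos-* (suc k) n) ⟨
    + x + + (suc k ℕ.* n)      ≡⟨ pos-+ x (suc k ℕ.* n) ⟨
    + (x ℕ.+ suc k ℕ.* n)      ∎))
    where
    open ≡-Reasoning
    move : ∀ x y {z} → x - y ≡ - z → y ≡ x + z
    move x y {z} e = trans (solve 2 (λ x y → y := x :+ :- (x :- y)) refl x y)
      (trans (cong (λ w → x + - w) e) (cong (_+_ x) (neg-involutive z)))

  mod-setoid : ℕ → Setoid 0ℓ 0ℓ
  mod-setoid n = record
    { Carrier       = ℤ
    ; _≈_           = _≡_mod n
    ; isEquivalence = record { refl = mod-reflexive refl ; sym = mod-sym ; trans = mod-trans }
    }

  mod-dec : ∀ x y n → Dec (x ≡ y mod n)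
  mod-dec x y n = map′ congruent divides-diff (+ n ∣? x - y)

  mod⇒%≡ : ∀ {x y n} .{{_ : NonZero n}} → + x ≡ + y mod n → x ℕ.% n ≡ y ℕ.% n
  mod⇒%≡ {x} {y} {n} x≡y = mod-<-injective (ℕ.m%n<n x n) (ℕ.m%n<n y n)
    (mod-trans (mod-sym (mod-%ℕ (+ x) n)) (mod-trans x≡y (mod-%ℕ (+ y) n)))

  %≡⇒mod : ∀ {x y n} .{{_ : NonZero n}} → x ℕ.% n ≡ y ℕ.% n → + x ≡ + y mod n
  %≡⇒mod {x} {y} {n} x%n≡y%n =
    mod-trans (mod-%ℕ (+ x) n) (subst (λ r → + r ≡ + y mod n) (sym x%n≡y%n) (mod-sym (mod-%ℕ (+ y) n)))

  mod-1 : ∀ x y → x ≡ y mod 1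
  mod-1 x y = congruent (divides (x - y) (sym (*-identityʳ (x - y))))

module RationalArithmetic where

  open import Defs using (frac)
  open import Data.Nat as ℕ using (ℕ; suc; NonZero)
  import Data.Nat.Properties as ℕ
  import Data.Nat.GCD as ℕ
  open import Data.Integer as ℤ using (ℤ; +_)
  import Data.Integer.Properties as ℤ
  open import Data.Integer.DivMod using (_%ℕ_; _/ℕ_; a≡a%ℕn+[a/ℕn]*n; n%ℕd<d)
  open import Data.Integer.Divisibility.Signed using (divides)
  open import Data.Integer.Solver using (module +-*-Solver)
  open import Data.Rational as ℚ using (ℚ; _/_; mkℚ; ↥_; ↧ₙ_; toℚᵘ; 1ℚ; ½)
  open import Data.Rational.Properties
    using (toℚᵘ-injective; toℚᵘ-fromℚᵘ; toℚᵘ-homo-+; toℚᵘ-homo-*; toℚᵘ-homo‿-; ↥-/; ↧-/;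
           toℚᵘ-mono-≤; toℚᵘ-cancel-≤; *-identityʳ)
  open import Data.Rational.Unnormalised as ℚᵘ using (mkℚᵘ; *≡*; *≤*)
  import Data.Rational.Unnormalised.Properties as ℚᵘ
  import Data.Rational.Solver as ℚ-Solver
  open import Relation.Binary.PropositionalEquality
  open IntegerCongruence
  open import Algebra.Properties.AbelianGroup ℤ.+-0-abelianGroup using () renaming (∙-cancelˡ to +-cancelˡ)

  fromℕ : ℕ → ℚ
  fromℕ n = + n / 1

  -- ℚ._/_ divides by a gcd, so identities between such literals are proved in ℚᵘ, through the
  -- injective toℚᵘ.
  toℚᵘ-/ : ∀ i n .{{_ : NonZero n}} → toℚᵘ (i / n) ℚᵘ.≃ mkℚᵘ i (ℕ.pred n)
  toℚᵘ-/ i (suc n) = toℚᵘ-fromℚᵘ (mkℚᵘ i n)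

  /-≡ : ∀ i j n k .{{_ : NonZero n}} .{{_ : NonZero k}} → i ℤ.* + k ≡ j ℤ.* + n → i / n ≡ j / k
  /-≡ i j n@(suc _) k@(suc _) ik≡jn =
    toℚᵘ-injective (ℚᵘ.≃-trans (toℚᵘ-/ i n) (ℚᵘ.≃-trans (*≡* ik≡jn) (ℚᵘ.≃-sym (toℚᵘ-/ j k))))

  /-+-/ : ∀ i j n k .{{_ : NonZero n}} .{{_ : NonZero k}} →
    i / n ℚ.+ j / k ≡ ℚ._/_ (i ℤ.* + k ℤ.+ j ℤ.* + n) (n ℕ.* k) {{ℕ.m*n≢0 n k}}
  /-+-/ i j n@(suc _) k@(suc _) = toℚᵘ-injective (ℚᵘ.≃-trans (toℚᵘ-homo-+ (i / n) (j / k))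
    (ℚᵘ.≃-trans (ℚᵘ.+-cong (toℚᵘ-/ i n) (toℚᵘ-/ j k)) (ℚᵘ.≃-sym (toℚᵘ-/ _ (n ℕ.* k)))))

  /-*-/ : ∀ i j n k .{{_ : NonZero n}} .{{_ : NonZero k}} →
    (i / n) ℚ.* (j / k) ≡ ℚ._/_ (i ℤ.* j) (n ℕ.* k) {{ℕ.m*n≢0 n k}}
  /-*-/ i j n@(suc _) k@(suc _) = toℚᵘ-injective (ℚᵘ.≃-trans (toℚᵘ-homo-* (i / n) (j / k))
    (ℚᵘ.≃-trans (ℚᵘ.*-cong (toℚᵘ-/ i n) (toℚᵘ-/ j k)) (ℚᵘ.≃-sym (toℚᵘ-/ _ (n ℕ.* k)))))

  -‿/ : ∀ i n .{{_ : NonZero n}} → ℚ.- (i / n) ≡ (ℤ.- i) / n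
  -‿/ i n@(suc _) = toℚᵘ-injective (ℚᵘ.≃-trans (toℚᵘ-homo‿- (i / n))
    (ℚᵘ.≃-trans (ℚᵘ.-‿cong (toℚᵘ-/ i n)) (ℚᵘ.≃-sym (toℚᵘ-/ (ℤ.- i) n))))

  /-cancel-≤ : ∀ u v n .{{_ : NonZero n}} → + u / n ℚ.≤ + v / n → u ℕ.≤ v
  /-cancel-≤ u v n@(suc _) u/n≤v/n
    with ℚᵘ.≤-respʳ-≃ (toℚᵘ-/ (+ v) n) (ℚᵘ.≤-respˡ-≃ (toℚᵘ-/ (+ u) n) (toℚᵘ-mono-≤ u/n≤v/n))
  ... | *≤* un≤vn = ℤ.drop‿+≤+ (ℤ.*-cancelʳ-≤-pos (+ u) (+ v) (+ n) un≤vn)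

  /-mono-≤ : ∀ u v n .{{_ : NonZero n}} → u ℕ.≤ v → + u / n ℚ.≤ + v / n
  /-mono-≤ u v n@(suc _) u≤v = toℚᵘ-cancel-≤
    (ℚᵘ.≤-respʳ-≃ (ℚᵘ.≃-sym (toℚᵘ-/ (+ v) n)) (ℚᵘ.≤-respˡ-≃ (ℚᵘ.≃-sym (toℚᵘ-/ (+ u) n))
      (*≤* (ℤ.*-monoʳ-≤-nonNeg (+ n) (ℤ.+≤+ u≤v)))))

  fromℕ-injective : ∀ {m n} → fromℕ m ≡ fromℕ n → m ≡ n
  fromℕ-injective {m} {n} m≡n = ℤ.+-injective (ℤ.*-cancelʳ-≡ (+ m) (+ n) (+ 1) m*1≡n*1)
    where
    m*1≡n*1 : + m ℤ.* + 1 ≡ + n ℤ.* + 1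
    m*1≡n*1 with ℚᵘ.≃-trans (ℚᵘ.≃-sym (toℚᵘ-/ (+ m) 1))
                   (ℚᵘ.≃-trans (ℚᵘ.≃-reflexive (cong toℚᵘ m≡n)) (toℚᵘ-/ (+ n) 1))
    ... | *≡* e = e

  fromℕ-+ : ∀ m n → fromℕ (m ℕ.+ n) ≡ fromℕ m ℚ.+ fromℕ n
  fromℕ-+ m n = sym (trans (/-+-/ (+ m) (+ n) 1 1)
    (/-≡ (+ m ℤ.* + 1 ℤ.+ + n ℤ.* + 1) (+ (m ℕ.+ n)) 1 1 (cong (ℤ._* + 1)
      (trans (cong₂ ℤ._+_ (ℤ.*-identityʳ (+ m)) (ℤ.*-identityʳ (+ n))) (sym (ℤ.pos-+ m n))))))

  fromℕ-* : ∀ m n → fromℕ (m ℕ.* n) ≡ fromℕ m ℚ.* fromℕ n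
  fromℕ-* m n = sym (trans (/-*-/ (+ m) (+ n) 1 1) (/-≡ (+ m ℤ.* + n) (+ (m ℕ.* n)) 1 1 (cong (ℤ._* + 1) (sym (ℤ.pos-* m n)))))

  /-fromℕ : ∀ x d .{{_ : NonZero d}} → + x / d ≡ fromℕ x ℚ.* (+ 1 / d)
  /-fromℕ x d = sym (trans (/-*-/ (+ x) (+ 1) 1 d) (/-≡ (+ x ℤ.* + 1) (+ x) (1 ℕ.* d) d {{ℕ.m*n≢0 1 d}}
    (trans (cong (ℤ._* + d) (ℤ.*-identityʳ (+ x))) (cong (λ k → + x ℤ.* + k) (sym (ℕ.*-identityˡ d))))))

  fromℕ-*-inverse : ∀ d .{{_ : NonZero d}} → fromℕ d ℚ.* (+ 1 / d) ≡ 1ℚ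
  fromℕ-*-inverse d = trans (sym (/-fromℕ d d)) (/-≡ (+ d) (+ 1) d 1 (trans (ℤ.*-identityʳ (+ d)) (sym (ℤ.*-identityˡ (+ d)))))

  /ℕ-unique : ∀ {i} r q n .{{_ : NonZero n}} → i ≡ + r ℤ.+ q ℤ.* + n → r ℕ.< n → i /ℕ n ≡ q
  /ℕ-unique {i} r q n i≡r+qn r<n =
    ℤ.*-cancelʳ-≡ (i /ℕ n) q (+ n) (+-cancelˡ (+ r) _ _
      (trans (cong (λ k → + k ℤ.+ (i /ℕ n) ℤ.* + n) (sym r₀≡r)) (trans (sym i≡r₀+q₀n) i≡r+qn)))
    where
    i≡r₀+q₀n : i ≡ + (i %ℕ n) ℤ.+ (i /ℕ n) ℤ.* + n
    i≡r₀+q₀n = a≡a%ℕn+[a/ℕn]*n i n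
    open +-*-Solver
    difference : ∀ r₀ q₀ r q n → r₀ ℤ.+ q₀ ℤ.* n ≡ r ℤ.+ q ℤ.* n → r₀ ℤ.- r ≡ (q ℤ.- q₀) ℤ.* n
    difference r₀ q₀ r q n e = trans (shift r₀ q₀ r n) (trans (cong (λ z → z ℤ.- r ℤ.- q₀ ℤ.* n) e) (collect r q q₀ n))
      where
      shift : ∀ r₀ q₀ r n → r₀ ℤ.- r ≡ r₀ ℤ.+ q₀ ℤ.* n ℤ.- r ℤ.- q₀ ℤ.* n
      shift = solve 4 (λ r₀ q₀ r n → r₀ :- r := r₀ :+ q₀ :* n :- r :- q₀ :* n) refl
      collect : ∀ r q q₀ n → r ℤ.+ q ℤ.* n ℤ.- r ℤ.- q₀ ℤ.* n ≡ (q ℤ.- q₀) ℤ.* n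
      collect = solve 4 (λ r q q₀ n → r :+ q :* n :- r :- q₀ :* n := (q :- q₀) :* n) refl
    r₀≡r : i %ℕ n ≡ r
    r₀≡r = mod-<-injective (n%ℕd<d i n) r<n
      (congruent (divides (q ℤ.- i /ℕ n) (difference (+ (i %ℕ n)) (i /ℕ n) (+ r) q (+ n) (trans (sym i≡r₀+q₀n) i≡r+qn))))

  floor-/ : ∀ i n .{{_ : NonZero n}} → ℚ.floor (i / n) ≡ i /ℕ n
  floor-/ i n@(suc _) = trans (floor-↥/↧ (i / n)) (sym (/ℕ-unique (r ℕ.* g) q n i≡rg+qn rg<n))
    where
    floor-↥/↧ : ∀ p → ℚ.floor p ≡ ↥ p /ℕ ↧ₙ p
    floor-↥/↧ (mkℚ N D-1 _) = ℤ.*-identityˡ (N /ℕ suc D-1)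
    N = ↥ (i / n)
    D = ↧ₙ (i / n)
    g = ℕ.gcd ℤ.∣ i ∣ n
    q = N /ℕ D
    r = N %ℕ D
    Dg≡n : D ℕ.* g ≡ n
    Dg≡n = ℤ.+-injective (trans (ℤ.pos-* D g) (↧-/ i n))
    i≡rg+qn : i ≡ + (r ℕ.* g) ℤ.+ q ℤ.* + n
    i≡rg+qn = begin
      i                                    ≡⟨ ↥-/ i n ⟨
      N ℤ.* + g                            ≡⟨ cong (ℤ._* + g) (a≡a%ℕn+[a/ℕn]*n N D) ⟩
      (+ r ℤ.+ q ℤ.* + D) ℤ.* + g          ≡⟨ distribute (+ r) q (+ D) (+ g) ⟩
      + r ℤ.* + g ℤ.+ q ℤ.* (+ D ℤ.* + g)
        ≡⟨ cong₂ (λ u v → u ℤ.+ q ℤ.* v) (ℤ.pos-* r g) (trans (cong +_ (sym Dg≡n)) (ℤ.pos-* D g)) ⟨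
      + (r ℕ.* g) ℤ.+ q ℤ.* + n            ∎
      where
      open ≡-Reasoning
      open +-*-Solver
      distribute : ∀ r q D g → (r ℤ.+ q ℤ.* D) ℤ.* g ≡ r ℤ.* g ℤ.+ q ℤ.* (D ℤ.* g)
      distribute = solve 4 (λ r q D g → (r :+ q :* D) :* g := r :* g :+ q :* (D :* g)) refl
    rg<n : r ℕ.* g ℕ.< n
    rg<n = subst (r ℕ.* g ℕ.<_) Dg≡n (ℕ.*-monoˡ-< g {{ℕ.≢-nonZero g≢0}} (n%ℕd<d N D))
      where
      g≢0 : g ≢ 0
      g≢0 g≡0 = ℕ.0≢1+n (trans (sym (trans (cong (D ℕ.*_) g≡0) (ℕ.*-zeroʳ D))) Dg≡n)

  frac-/ : ∀ i n .{{_ : NonZero n}} → frac (i / n) ≡ + (i %ℕ n) / n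
  frac-/ i n@(suc _) = begin
    i / n ℚ.+ ℚ.- (ℚ.floor (i / n) / 1)  ≡⟨ cong (λ z → i / n ℚ.+ ℚ.- (z / 1)) (floor-/ i n) ⟩
    i / n ℚ.+ ℚ.- (q / 1)                 ≡⟨ cong (i / n ℚ.+_) (-‿/ q 1) ⟩
    i / n ℚ.+ (ℤ.- q) / 1                 ≡⟨ /-+-/ i (ℤ.- q) n 1 ⟩
    ℚ._/_ (i ℤ.* + 1 ℤ.+ (ℤ.- q) ℤ.* + n) (n ℕ.* 1) {{ℕ.m*n≢0 n 1}}
      ≡⟨ /-≡ (i ℤ.* + 1 ℤ.+ (ℤ.- q) ℤ.* + n) (+ (i %ℕ n)) (n ℕ.* 1) n {{ℕ.m*n≢0 n 1}} cross ⟩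
    + (i %ℕ n) / n                        ∎
    where
    open ≡-Reasoning
    q = i /ℕ n
    cross : (i ℤ.* + 1 ℤ.+ (ℤ.- q) ℤ.* + n) ℤ.* + n ≡ + (i %ℕ n) ℤ.* + (n ℕ.* 1)
    cross = trans (cong (λ z → (z ℤ.* + 1 ℤ.+ (ℤ.- q) ℤ.* + n) ℤ.* + n) (a≡a%ℕn+[a/ℕn]*n i n))
              (trans (cancel (+ (i %ℕ n)) q (+ n)) (cong (λ k → + (i %ℕ n) ℤ.* + k) (sym (ℕ.*-identityʳ n))))
      where
      open +-*-Solver
      cancel : ∀ r q n → ((r ℤ.+ q ℤ.* n) ℤ.* + 1 ℤ.+ (ℤ.- q) ℤ.* n) ℤ.* n ≡ r ℤ.* n
      cancel = solve 3 (λ r q n → ((r :+ q :* n) :* con (+ 1) :+ (:- q) :* n) :* n := r :* n) refl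

  frac-*-frac : ∀ k i d .{{_ : NonZero d}} → frac (fromℕ k ℚ.* frac (i / d)) ≡ + ((k ℕ.* (i %ℕ d)) ℕ.% d) / d
  frac-*-frac k i d = begin
    frac (fromℕ k ℚ.* frac (i / d))           ≡⟨ cong (λ z → frac (fromℕ k ℚ.* z)) (frac-/ i d) ⟩
    frac (fromℕ k ℚ.* (+ (i %ℕ d) / d))       ≡⟨ cong frac (trans (/-*-/ (+ k) (+ (i %ℕ d)) 1 d) k*r/d) ⟩
    frac (+ (k ℕ.* (i %ℕ d)) / d)             ≡⟨ frac-/ (+ (k ℕ.* (i %ℕ d))) d ⟩
    + ((k ℕ.* (i %ℕ d)) ℕ.% d) / d            ∎
    where
    open ≡-Reasoning
    k*r/d : ℚ._/_ (+ k ℤ.* + (i %ℕ d)) (1 ℕ.* d) {{ℕ.m*n≢0 1 d}} ≡ + (k ℕ.* (i %ℕ d)) / d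
    k*r/d = /-≡ (+ k ℤ.* + (i %ℕ d)) (+ (k ℕ.* (i %ℕ d))) (1 ℕ.* d) d {{ℕ.m*n≢0 1 d}}
      (cong₂ ℤ._*_ (sym (ℤ.pos-* k (i %ℕ d))) (cong +_ (sym (ℕ.*-identityˡ d))))

  *-frac-/ : ∀ ν x d .{{_ : NonZero d}} → fromℕ ν ≡ fromℕ d ℚ.* frac (+ x / d) → ν ≡ x ℕ.% d
  *-frac-/ ν x d ν≡d*frac = fromℕ-injective (begin
    fromℕ ν                                         ≡⟨ ν≡d*frac ⟩
    fromℕ d ℚ.* frac (+ x / d)                      ≡⟨ cong (fromℕ d ℚ.*_) (trans (frac-/ (+ x) d) (/-fromℕ (x ℕ.% d) d)) ⟩
    fromℕ d ℚ.* (fromℕ (x ℕ.% d) ℚ.* (+ 1 / d))     ≡⟨ swap (fromℕ d) (fromℕ (x ℕ.% d)) (+ 1 / d) ⟩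
    fromℕ (x ℕ.% d) ℚ.* (fromℕ d ℚ.* (+ 1 / d))     ≡⟨ cong (fromℕ (x ℕ.% d) ℚ.*_) (fromℕ-*-inverse d) ⟩
    fromℕ (x ℕ.% d) ℚ.* 1ℚ                          ≡⟨ *-identityʳ _ ⟩
    fromℕ (x ℕ.% d)                                 ∎)
    where
    open ≡-Reasoning
    open ℚ-Solver.+-*-Solver
    swap : ∀ x y z → x ℚ.* (y ℚ.* z) ≡ y ℚ.* (x ℚ.* z)
    swap = solve 3 (λ x y z → x :* (y :* z) := y :* (x :* z)) refl

  fromℕ≡/ : ∀ g₁ g₂ d .{{_ : NonZero d}} → d ℕ.* g₂ ≡ g₁ → fromℕ g₂ ≡ + g₁ / d
  fromℕ≡/ g₁ g₂ d dg₂≡g₁ = /-≡ (+ g₂) (+ g₁) 1 d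
    (trans (sym (ℤ.pos-* g₂ d)) (trans (cong +_ (trans (ℕ.*-comm g₂ d) dg₂≡g₁)) (sym (ℤ.*-identityʳ (+ g₁)))))

  /≡/*½ : ∀ g P d .{{_ : NonZero d}} → g ℕ.+ g ≡ P → + g / d ≡ (+ P / d) ℚ.* ½
  /≡/*½ g P d g+g≡P = sym (trans (/-*-/ (+ P) (+ 1) d 2) (/-≡ (+ P ℤ.* + 1) (+ g) (d ℕ.* 2) d {{ℕ.m*n≢0 d 2}} cross))
    where
    open +-*-Solver
    double : ∀ g d → ((g ℤ.+ g) ℤ.* + 1) ℤ.* d ≡ g ℤ.* (d ℤ.* + 2)
    double = solve 2 (λ g d → ((g :+ g) :* con (+ 1)) :* d := g :* (d :* con (+ 2))) refl
    cross : (+ P ℤ.* + 1) ℤ.* + d ≡ + g ℤ.* + (d ℕ.* 2)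
    cross = trans (cong (λ z → (z ℤ.* + 1) ℤ.* + d) (trans (cong +_ (sym g+g≡P)) (ℤ.pos-+ g g)))
                  (trans (double (+ g) (+ d)) (cong (+ g ℤ.*_) (sym (ℤ.pos-* d 2))))

  halve-identity : ∀ g₁ g₂ C ν β d .{{_ : NonZero d}} →
    d ℕ.* (g₂ ℕ.+ g₂) ℕ.+ d ℕ.+ ν ℕ.* β ≡ (g₁ ℕ.+ g₁) ℕ.+ d ℕ.* C →
    fromℕ g₂ ≡ + g₁ / d ℚ.+ ½ ℚ.* (fromℕ C ℚ.- 1ℚ ℚ.- (+ β / d) ℚ.* fromℕ ν)
  halve-identity g₁ g₂ C ν β d identity = begin
    G₂                                         ≡⟨ trans (cong (G₂ ℚ.*_) (fromℕ-*-inverse d)) (*-identityʳ G₂) ⟨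
    G₂ ℚ.* (D ℚ.* I)                           ≡⟨ expand G₂ D I N B ⟩
    ½ ℚ.* I ℚ.* (D ℚ.* (G₂ ℚ.+ G₂) ℚ.+ D ℚ.+ N ℚ.* B) ℚ.- ½ ℚ.* I ℚ.* (D ℚ.+ N ℚ.* B)
      ≡⟨ cong (λ z → ½ ℚ.* I ℚ.* z ℚ.- ½ ℚ.* I ℚ.* (D ℚ.+ N ℚ.* B)) identityℚ ⟩
    ½ ℚ.* I ℚ.* ((G₁ ℚ.+ G₁) ℚ.+ D ℚ.* K) ℚ.- ½ ℚ.* I ℚ.* (D ℚ.+ N ℚ.* B)
      ≡⟨ collect G₁ D I N B K ⟩
    G₁ ℚ.* I ℚ.+ ½ ℚ.* (K ℚ.* (D ℚ.* I) ℚ.- D ℚ.* I ℚ.- B ℚ.* I ℚ.* N)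
      ≡⟨ cong (λ u → G₁ ℚ.* I ℚ.+ ½ ℚ.* (K ℚ.* u ℚ.- u ℚ.- B ℚ.* I ℚ.* N)) (fromℕ-*-inverse d) ⟩
    G₁ ℚ.* I ℚ.+ ½ ℚ.* (K ℚ.* 1ℚ ℚ.- 1ℚ ℚ.- B ℚ.* I ℚ.* N)
      ≡⟨ cong (λ z → G₁ ℚ.* I ℚ.+ ½ ℚ.* (z ℚ.- 1ℚ ℚ.- B ℚ.* I ℚ.* N)) (*-identityʳ K) ⟩
    G₁ ℚ.* I ℚ.+ ½ ℚ.* (K ℚ.- 1ℚ ℚ.- B ℚ.* I ℚ.* N)
      ≡⟨ cong₂ (λ u v → u ℚ.+ ½ ℚ.* (K ℚ.- 1ℚ ℚ.- v ℚ.* N)) (/-fromℕ g₁ d) (/-fromℕ β d) ⟨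
    + g₁ / d ℚ.+ ½ ℚ.* (K ℚ.- 1ℚ ℚ.- (+ β / d) ℚ.* N) ∎
    where
    open ≡-Reasoning
    open ℚ-Solver.+-*-Solver
    G₁ = fromℕ g₁
    G₂ = fromℕ g₂
    D = fromℕ d
    I = + 1 / d
    N = fromℕ ν
    B = fromℕ β
    K = fromℕ C
    identityℚ : D ℚ.* (G₂ ℚ.+ G₂) ℚ.+ D ℚ.+ N ℚ.* B ≡ (G₁ ℚ.+ G₁) ℚ.+ D ℚ.* K
    identityℚ = begin
      D ℚ.* (G₂ ℚ.+ G₂) ℚ.+ D ℚ.+ N ℚ.* B
        ≡⟨ cong₂ ℚ._+_ (cong (ℚ._+ D) (trans (fromℕ-* d (g₂ ℕ.+ g₂)) (cong (D ℚ.*_) (fromℕ-+ g₂ g₂))))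
                       (fromℕ-* ν β) ⟨
      fromℕ (d ℕ.* (g₂ ℕ.+ g₂)) ℚ.+ D ℚ.+ fromℕ (ν ℕ.* β)
        ≡⟨ cong (ℚ._+ fromℕ (ν ℕ.* β)) (fromℕ-+ (d ℕ.* (g₂ ℕ.+ g₂)) d) ⟨
      fromℕ (d ℕ.* (g₂ ℕ.+ g₂) ℕ.+ d) ℚ.+ fromℕ (ν ℕ.* β)
        ≡⟨ fromℕ-+ (d ℕ.* (g₂ ℕ.+ g₂) ℕ.+ d) (ν ℕ.* β) ⟨
      fromℕ (d ℕ.* (g₂ ℕ.+ g₂) ℕ.+ d ℕ.+ ν ℕ.* β)
        ≡⟨ cong fromℕ identity ⟩
      fromℕ ((g₁ ℕ.+ g₁) ℕ.+ d ℕ.* C)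
        ≡⟨ trans (fromℕ-+ (g₁ ℕ.+ g₁) (d ℕ.* C)) (cong₂ ℚ._+_ (fromℕ-+ g₁ g₁) (fromℕ-* d C)) ⟩
      (G₁ ℚ.+ G₁) ℚ.+ D ℚ.* K ∎
    expand : ∀ G₂ D I N B → G₂ ℚ.* (D ℚ.* I) ≡
      ½ ℚ.* I ℚ.* (D ℚ.* (G₂ ℚ.+ G₂) ℚ.+ D ℚ.+ N ℚ.* B) ℚ.- ½ ℚ.* I ℚ.* (D ℚ.+ N ℚ.* B)
    expand = solve 5 (λ G₂ D I N B → G₂ :* (D :* I) :=
      con ½ :* I :* (D :* (G₂ :+ G₂) :+ D :+ N :* B) :- con ½ :* I :* (D :+ N :* B)) refl
    collect : ∀ G₁ D I N B K → ½ ℚ.* I ℚ.* ((G₁ ℚ.+ G₁) ℚ.+ D ℚ.* K) ℚ.- ½ ℚ.* I ℚ.* (D ℚ.+ N ℚ.* B) ≡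
      G₁ ℚ.* I ℚ.+ ½ ℚ.* (K ℚ.* (D ℚ.* I) ℚ.- D ℚ.* I ℚ.- B ℚ.* I ℚ.* N)
    collect = solve 6 (λ G₁ D I N B K → con ½ :* I :* ((G₁ :+ G₁) :+ D :* K) :- con ½ :* I :* (D :+ N :* B) :=
      G₁ :* I :+ con ½ :* (K :* (D :* I) :- D :* I :- B :* I :* N)) refl

module NumericalSemigroupGaps where

  open import Defs
  open FiniteSums
  open IntegerCongruence
  open import Data.Nat
  open import Data.Nat.Properties
  open import Data.Nat.DivMod using (_/_; m*n/n≡m)
  open import Data.Nat.Coprimality as Coprimality using (Coprime)
  open import Data.Integer as ℤ using (+_)
  import Data.Integer.Properties as ℤ
  open import Data.Integer.DivMod using (_%ℕ_; n%ℕd<d)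
  open import Data.List using (List; []; length; filter; upTo; _++_; map)
  open import Data.List.Properties using (length-++; length-map)
  open import Data.List.Relation.Unary.Unique.Propositional using (Unique; [])
  open import Data.List.Relation.Unary.Unique.Propositional.Properties using (filter⁺; upTo⁺; ++⁺)
  open import Data.List.Membership.Propositional using (_∈_)
  open import Data.List.Membership.Propositional.Properties
    using (∈-map⁺; ∈-map⁻; ∈-filter⁺; ∈-filter⁻; ∈-upTo⁺; ∈-++⁺ˡ; ∈-++⁺ʳ; ∈-++⁻)
  open import Data.Product using (∃; _×_; _,_; proj₁; proj₂)
  open import Data.Sum using (inj₁; inj₂)
  open import Data.Empty using (⊥-elim)
  open import Function.Bundles using (_⇔_; mk⇔; Equivalence)
  open import Relation.Binary.PropositionalEquality
  open import Relation.Nullary using (Dec; yes; no; ¬_)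
  open import Relation.Nullary.Decidable using (_×-dec_; map′)

  module _ {S : ℕ → Set} where

    isGenus-unique : ∀ {g g′} → IsGenus S g → IsGenus S g′ → g ≡ g′
    isGenus-unique (l , ul , l⇔∉S , refl) (l′ , ul′ , l′⇔∉S , refl) = length-unique-⇔ ul ul′ λ n →
      mk⇔ (λ n∈l → Equivalence.from (l′⇔∉S n) (Equivalence.to (l⇔∉S n) n∈l))
          (λ n∈l′ → Equivalence.from (l⇔∉S n) (Equivalence.to (l′⇔∉S n) n∈l′))

    isGenus-resp : ∀ {T g} → (∀ n → S n ⇔ T n) → IsGenus S g → IsGenus T g
    isGenus-resp {T} S⇔T (l , ul , l⇔∉S , len) = l , ul , l⇔∉T , len
      where
      l⇔∉T : ∀ n → (n ∈ l) ⇔ (¬ T n)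
      l⇔∉T n = mk⇔ (λ n∈l Tn → Equivalence.to (l⇔∉S n) n∈l (Equivalence.from (S⇔T n) Tn))
                   (λ ∉T → Equivalence.from (l⇔∉S n) (λ Sn → ∉T (Equivalence.to (S⇔T n) Sn)))

  module TwoGenerator (a b : ℕ) .{{_ : NonZero b}} (a⊥b : Coprime a b) where

    S : ℕ → Set
    S = ⟨ a , b ⟩

    residue-injective : ∀ {p p′} → p < b → p′ < b → + (p * a) ≡ + (p′ * a) mod b → p ≡ p′
    residue-injective {p} {p′} p<b p′<b pa≡p′a = mod-<-injective p<b p′<b
      (mod-cancelˡ a (Coprimality.sym a⊥b) (subst₂ (_≡_mod b) (+[m*n]≡+n*+m p a) (+[m*n]≡+n*+m p′ a) pa≡p′a))

    ∉-intro : ∀ {n p q} → p < b → 0 < q → n + q * b ≡ p * a → ¬ S n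
    ∉-intro {n} {p} {q} p<b 0<q n+qb≡pa (u , v , ua+vb≡n) with p ≤? u
    ... | yes p≤u = <-irrefl refl (begin-strict
      p * a          ≤⟨ *-monoˡ-≤ a p≤u ⟩
      u * a          ≤⟨ m≤m+n (u * a) (v * b) ⟩
      u * a + v * b  ≡⟨ ua+vb≡n ⟩
      n              <⟨ m<m+n n (*-monoˡ-< b 0<q) ⟩
      n + q * b      ≡⟨ n+qb≡pa ⟩
      p * a          ∎)
      where open ≤-Reasoning
    ... | no p≰u = <-irrefl (residue-injective {u} {p} (<-trans u<p p<b) p<b ua≡pa) u<p
      where
      u<p = ≰⇒> p≰u
      ua+[v+q]b≡pa : u * a + (v + q) * b ≡ p * a
      ua+[v+q]b≡pa = begin
        u * a + (v + q) * b        ≡⟨ cong (_+_ (u * a)) (*-distribʳ-+ b v q) ⟩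
        u * a + (v * b + q * b)    ≡⟨ +-assoc (u * a) (v * b) (q * b) ⟨
        u * a + v * b + q * b      ≡⟨ cong (_+ q * b) ua+vb≡n ⟩
        n + q * b                  ≡⟨ n+qb≡pa ⟩
        p * a                      ∎
        where open ≡-Reasoning
      ua≡pa : + (u * a) ≡ + (p * a) mod b
      ua≡pa = mod-sym (subst (λ m → + m ≡ + (u * a) mod b) ua+[v+q]b≡pa (mod-+* (u * a) (v + q) b))

    a⁻¹ : ℤ.ℤ
    a⁻¹ = proj₁ (mod-inverse a⊥b)

    residue : ℕ → ℕ
    residue n = (+ n ℤ.* a⁻¹) %ℕ b

    residue<b : ∀ n → residue n < b
    residue<b n = n%ℕd<d (+ n ℤ.* a⁻¹) b

    residue*a≡ : ∀ n → + (residue n * a) ≡ + n mod b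
    residue*a≡ n = begin
      + (residue n * a)             ≡⟨ ℤ.pos-* (residue n) a ⟩
      + residue n ℤ.* + a           ≈⟨ mod-*ʳ (+ a) (mod-sym (mod-%ℕ (+ n ℤ.* a⁻¹) b)) ⟩
      + n ℤ.* a⁻¹ ℤ.* + a           ≡⟨ ℤ.*-assoc (+ n) a⁻¹ (+ a) ⟩
      + n ℤ.* (a⁻¹ ℤ.* + a)         ≈⟨ mod-*ˡ (+ n) (proj₂ (mod-inverse a⊥b)) ⟩
      + n ℤ.* + 1                   ≡⟨ ℤ.*-identityʳ (+ n) ⟩
      + n                           ∎
      where open import Relation.Binary.Reasoning.Setoid (mod-setoid b)

    ∉-elim : ∀ {n p} → + (p * a) ≡ + n mod b → ¬ S n → ∃ λ q → 0 < q × n + q * b ≡ p * a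
    ∉-elim {n} {p} pa≡n n∉S with mod⇒+* {p * a} {n} {b} pa≡n
    ... | inj₁ (zero  , pa≡n+0)  = ⊥-elim (n∉S (p , 0 , trans (+-identityʳ (p * a)) (trans pa≡n+0 (+-identityʳ n))))
    ... | inj₁ (suc k , pa≡n+kb) = suc k , z<s , sym pa≡n+kb
    ... | inj₂ (k , n≡pa+kb)     = ⊥-elim (n∉S (p , k , sym n≡pa+kb))

  module QuotientGaps (a b d : ℕ) .{{_ : NonZero b}} .{{_ : NonZero d}} (a⊥b : Coprime a b) where

    open TwoGenerator a b a⊥b

    record GapPair (p q : ℕ) : Set where
      constructor gapPair
      field
        0<q   : 0 < q
        qb<pa : q * b < p * a
        pa≡qb : + (p * a) ≡ + (q * b) mod d

    gapPair? : ∀ p q → Dec (GapPair p q)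
    gapPair? p q = map′ (λ (0<q , qb<pa , pa≡qb) → gapPair 0<q qb<pa pa≡qb)
                        (λ (gapPair 0<q qb<pa pa≡qb) → 0<q , qb<pa , pa≡qb)
                        (0 <? q ×-dec q * b <? p * a ×-dec mod-dec (+ (p * a)) (+ (q * b)) d)

    gapOf : ℕ → ℕ → ℕ
    gapOf p q = (p * a ∸ q * b) / d

    gapOf-spec : ∀ {p q} → GapPair p q → d * gapOf p q + q * b ≡ p * a
    gapOf-spec {p} {q} (gapPair _ qb<pa pa≡qb) with mod⇒+* pa≡qb
    ... | inj₁ (k , pa≡qb+kd) = begin
      d * ((p * a ∸ q * b) / d) + q * b    ≡⟨ cong (λ m → d * ((m ∸ q * b) / d) + q * b) pa≡qb+kd ⟩
      d * ((q * b + k * d ∸ q * b) / d) + q * b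
        ≡⟨ cong (λ m → d * (m / d) + q * b) (m+n∸m≡n (q * b) (k * d)) ⟩
      d * (k * d / d) + q * b              ≡⟨ cong (λ m → d * m + q * b) (m*n/n≡m k d) ⟩
      d * k + q * b                        ≡⟨ +-comm (d * k) (q * b) ⟩
      q * b + d * k                        ≡⟨ cong (_+_ (q * b)) (*-comm d k) ⟩
      q * b + k * d                        ≡⟨ pa≡qb+kd ⟨
      p * a                                ∎
      where open ≡-Reasoning
    ... | inj₂ (k , qb≡pa+kd) = ⊥-elim (<⇒≱ qb<pa (subst (_≤_ (p * a)) (sym qb≡pa+kd) (m≤m+n (p * a) (k * d))))

    gapOf-injective : ∀ {p q p′ q′} → GapPair p q → GapPair p′ q′ → p < b → p′ < b →
      gapOf p q ≡ gapOf p′ q′ → p ≡ p′ × q ≡ q′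
    gapOf-injective {p} {q} {p′} {q′} pq p′q′ p<b p′<b x≡x′ = p≡p′ , q≡q′
      where
      x = gapOf p q
      dx+qb≡pa : d * x + q * b ≡ p * a
      dx+qb≡pa = gapOf-spec pq
      dx+q′b≡p′a : d * x + q′ * b ≡ p′ * a
      dx+q′b≡p′a = trans (cong (λ y → d * y + q′ * b) x≡x′) (gapOf-spec p′q′)
      p≡p′ : p ≡ p′
      p≡p′ = residue-injective p<b p′<b (mod-trans
        (subst (λ m → + m ≡ + (d * x) mod b) dx+qb≡pa (mod-+* (d * x) q b))
        (mod-sym (subst (λ m → + m ≡ + (d * x) mod b) dx+q′b≡p′a (mod-+* (d * x) q′ b))))
      q≡q′ : q ≡ q′
      q≡q′ = *-cancelʳ-≡ q q′ b (+-cancelˡ-≡ (d * x) (q * b) (q′ * b)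
        (trans dx+qb≡pa (trans (cong (_* a) p≡p′) (sym dx+q′b≡p′a))))

    gapOf-∉ : ∀ {p q} → GapPair p q → p < b → ¬ S (d * gapOf p q)
    gapOf-∉ pq p<b = ∉-intro p<b (GapPair.0<q pq) (gapOf-spec pq)

    ∉⇒gapOf : ∀ {x p} → p < b → + (p * a) ≡ + (d * x) mod b → ¬ S (d * x) →
      ∃ λ q → q < a × GapPair p q × gapOf p q ≡ x
    ∉⇒gapOf {x} {p} p<b pa≡dx dx∉S with ∉-elim {d * x} {p} pa≡dx dx∉S
    ... | q , 0<q , dx+qb≡pa = q , q<a , gapPair 0<q qb<pa pa≡qb , gapOf≡x
      where
      0<dx : 0 < d * x
      0<dx = subst (_< d * x) (*-zeroʳ d) (*-monoʳ-< d (n≢0⇒n>0 λ x≡0 →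
        dx∉S (0 , 0 , sym (trans (cong (d *_) x≡0) (*-zeroʳ d)))))
      qb<pa : q * b < p * a
      qb<pa = subst (_<_ (q * b)) (trans (+-comm (q * b) (d * x)) dx+qb≡pa) (m<m+n (q * b) 0<dx)
      q<a : q < a
      q<a = *-cancelʳ-< b q a (<-≤-trans qb<pa (subst (_≤_ (p * a)) (*-comm b a) (*-monoˡ-≤ a (<⇒≤ p<b))))
      pa≡qb+xd : p * a ≡ q * b + x * d
      pa≡qb+xd = trans (sym dx+qb≡pa) (trans (+-comm (d * x) (q * b)) (cong (_+_ (q * b)) (*-comm d x)))
      pa≡qb : + (p * a) ≡ + (q * b) mod d
      pa≡qb = subst (λ m → + m ≡ + (q * b) mod d) (sym pa≡qb+xd) (mod-+* (q * b) x d)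
      gapOf≡x : gapOf p q ≡ x
      gapOf≡x = trans (cong (λ m → (m ∸ q * b) / d) pa≡qb+xd) (trans (cong (_/ d) (m+n∸m≡n (q * b) (x * d))) (m*n/n≡m x d))

    gapsBelow : ℕ → List ℕ
    gapsBelow zero    = []
    gapsBelow (suc p) = gapsBelow p ++ map (gapOf p) (filter (gapPair? p) (upTo a))

    ∈-gapsBelow⁻ : ∀ n {x} → x ∈ gapsBelow n → ∃ λ p → p < n × ∃ λ q → GapPair p q × gapOf p q ≡ x
    ∈-gapsBelow⁻ (suc n) x∈ with ∈-++⁻ (gapsBelow n) x∈
    ... | inj₁ x∈gapsBelow with ∈-gapsBelow⁻ n x∈gapsBelow
    ...   | p , p<n , rest = p , m<n⇒m<1+n p<n , rest
    ∈-gapsBelow⁻ (suc n) x∈ | inj₂ x∈block with ∈-map⁻ (gapOf n) x∈block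
    ...   | q , q∈ , x≡gap = n , n<1+n n , q , proj₂ (∈-filter⁻ (gapPair? n) {xs = upTo a} q∈) , sym x≡gap

    ∈-gapsBelow⁺ : ∀ n {p q} → p < n → q < a → GapPair p q → gapOf p q ∈ gapsBelow n
    ∈-gapsBelow⁺ (suc n) {p} p<1+n q<a pq with p ≟ n
    ... | yes refl = ∈-++⁺ʳ (gapsBelow n) (∈-map⁺ (gapOf n) (∈-filter⁺ (gapPair? n) (∈-upTo⁺ q<a) pq))
    ... | no  p≢n  = ∈-++⁺ˡ (∈-gapsBelow⁺ n (≤∧≢⇒< (≤-pred p<1+n) p≢n) q<a pq)

    gapsBelow-unique : ∀ n → n ≤ b → Unique (gapsBelow n)
    gapsBelow-unique zero    _     = []
    gapsBelow-unique (suc n) 1+n≤b = ++⁺ (gapsBelow-unique n (<⇒≤ 1+n≤b)) unique-block disjoint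
      where
      gapPair-∈ : ∀ {q} → q ∈ filter (gapPair? n) (upTo a) → GapPair n q
      gapPair-∈ q∈ = proj₂ (∈-filter⁻ (gapPair? n) {xs = upTo a} q∈)
      unique-block : Unique (map (gapOf n) (filter (gapPair? n) (upTo a)))
      unique-block = unique-map⁺ (gapOf n)
        (λ q∈ q′∈ x≡x′ → proj₂ (gapOf-injective (gapPair-∈ q∈) (gapPair-∈ q′∈) 1+n≤b 1+n≤b x≡x′))
        (filter⁺ (gapPair? n) (upTo⁺ a))
      disjoint : ∀ {x} → ¬ (x ∈ gapsBelow n × x ∈ map (gapOf n) (filter (gapPair? n) (upTo a)))
      disjoint (x∈ , x∈block) with ∈-gapsBelow⁻ n x∈ | ∈-map⁻ (gapOf n) x∈block
      ... | p , p<n , q′ , pq′ , gap≡x | q , q∈ , x≡ =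
        <-irrefl (proj₁ (gapOf-injective pq′ (gapPair-∈ q∈) (<-trans p<n 1+n≤b) 1+n≤b (trans gap≡x x≡))) p<n

    length-gapsBelow : ∀ n → length (gapsBelow n) ≡ ∑[ p < n ] ∑[ q < a ] 𝟙 (gapPair? p q)
    length-gapsBelow zero    = refl
    length-gapsBelow (suc n) = trans (length-++ (gapsBelow n))
      (cong₂ _+_ (length-gapsBelow n) (trans (length-map (gapOf n) (filter (gapPair? n) (upTo a))) (length-filter-upTo (gapPair? n) a)))

    isGenus-quotient : IsGenus (S /ˢ d) (∑[ p < b ] ∑[ q < a ] 𝟙 (gapPair? p q))
    isGenus-quotient = gapsBelow b , gapsBelow-unique b ≤-refl , ∈⇔∉ , length-gapsBelow b
      where
      ∈⇔∉ : ∀ x → (x ∈ gapsBelow b) ⇔ (¬ S (d * x))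
      ∈⇔∉ x = mk⇔ to from
        where
        to : x ∈ gapsBelow b → ¬ S (d * x)
        to x∈ with ∈-gapsBelow⁻ b x∈
        ... | p , p<b , q , pq , gap≡x = subst (λ y → ¬ S (d * y)) gap≡x (gapOf-∉ {p} {q} pq p<b)
        from : ¬ S (d * x) → x ∈ gapsBelow b
        from dx∉S = gapOf∈ (residue<b (d * x)) (∉⇒gapOf {x} {residue (d * x)} (residue<b (d * x)) (residue*a≡ (d * x)) dx∉S)
          where
          gapOf∈ : ∀ {p} → p < b → (∃ λ q → q < a × GapPair p q × gapOf p q ≡ x) → x ∈ gapsBelow b
          gapOf∈ p<b (q , q<a , pq , gap≡x) = subst (_∈ gapsBelow b) gap≡x (∈-gapsBelow⁺ b p<b q<a pq)

module GapCount where

  open import Defs using (IsGenus; ⟨_,_⟩; _/ˢ_)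
  open FiniteSums
  open IntegerCongruence
  open NumericalSemigroupGaps
  open import Data.Nat
  open import Data.Nat.Properties
  open import Data.Nat.DivMod using (_/_; _%_; m*n%n≡0; m≡m%n+[m/n]*n; m%n<n; m<n⇒m%n≡m; m<n⇒m/n≡0)
  open import Data.Nat.Divisibility using (divides; ∣⇒≤)
  open import Data.Nat.Coprimality as Coprimality using (Coprime)
  open import Data.Integer as ℤ using (+_)
  import Data.Integer.Properties as ℤ
  import Data.Integer.Divisibility.Signed as ℤD
  open import Data.Integer.DivMod using (_%ℕ_; n%ℕd<d)
  open import Data.Integer.Solver using (module +-*-Solver)
  open import Data.Nat.Solver using () renaming (module +-*-Solver to ℕ-Solver)
  open import Data.Product using (∃; _×_; _,_; proj₁; proj₂)
  open import Data.Sum using (_⊎_; inj₁; inj₂)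
  open import Data.Empty using (⊥-elim)
  open import Relation.Binary.PropositionalEquality
  open import Relation.Binary.Definitions using (tri<; tri≈; tri>)
  open import Relation.Nullary using (Dec; yes; no)

  module GenusFormula (a b d : ℕ) .{{_ : NonZero a}} .{{_ : NonZero b}} .{{_ : NonZero d}}
    (a⊥b : Coprime a b) (a⊥d : Coprime a d) (b⊥d : Coprime b d)
    (m : ℕ) (am≡b : + a ℤ.* + m ≡ + b mod d) where

    open QuotientGaps a b d a⊥b using (GapPair; gapPair; gapPair?; isGenus-quotient)

    sameResidue? : ∀ p q → Dec (+ (p * a) ≡ + (q * b) mod d)
    sameResidue? p q = mod-dec (+ (p * a)) (+ (q * b)) d

    genus : ℕ
    genus = ∑[ p < b ] ∑[ q < a ] 𝟙 (gapPair? p q)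

    isGenus-genus : IsGenus (⟨ a , b ⟩ /ˢ d) genus
    isGenus-genus = isGenus-quotient

    flip-residue : ∀ {p q} → p ≤ b → q ≤ a →
      + ((b ∸ p) * a) ℤ.- + ((a ∸ q) * b) ≡ + (q * b) ℤ.- + (p * a)
    flip-residue {p} {q} p≤b q≤a = begin
      + ((b ∸ p) * a) ℤ.- + ((a ∸ q) * b)
        ≡⟨ cong₂ ℤ._-_ (trans (ℤ.pos-* (b ∸ p) a) (cong (ℤ._* + a) (pos-∸ p≤b)))
                       (trans (ℤ.pos-* (a ∸ q) b) (cong (ℤ._* + b) (pos-∸ q≤a))) ⟩
      (+ b ℤ.- + p) ℤ.* + a ℤ.- (+ a ℤ.- + q) ℤ.* + b   ≡⟨ expand (+ a) (+ b) (+ p) (+ q) ⟩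
      + q ℤ.* + b ℤ.- + p ℤ.* + a                       ≡⟨ cong₂ ℤ._-_ (ℤ.pos-* q b) (ℤ.pos-* p a) ⟨
      + (q * b) ℤ.- + (p * a)                           ∎
      where
      open ≡-Reasoning
      open +-*-Solver
      pos-∸ : ∀ {x y} → y ≤ x → + (x ∸ y) ≡ + x ℤ.- + y
      pos-∸ {x} {y} y≤x = trans (sym (ℤ.⊖-≥ y≤x)) (sym (ℤ.m-n≡m⊖n x y))
      expand : ∀ a b p q → (b ℤ.- p) ℤ.* a ℤ.- (a ℤ.- q) ℤ.* b ≡ q ℤ.* b ℤ.- p ℤ.* a
      expand = solve 4 (λ a b p q → (b :- p) :* a :- (a :- q) :* b := q :* b :- p :* a) refl

    flip-< : ∀ {p q} → p < b → q < a → (a ∸ q) * b < (b ∸ p) * a → p * a < q * b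
    flip-< {p} {q} p<b q<a lt = ∸-cancelʳ-< {o = a * b}
      (subst₂ _<_ (*-distribʳ-∸ b a q) (trans (*-distribʳ-∸ a b p) (cong (_∸ p * a) (*-comm b a))) lt)

    flip-<⁻ : ∀ {p q} → p < b → q < a → p * a < q * b → (a ∸ q) * b < (b ∸ p) * a
    flip-<⁻ {p} {q} p<b q<a lt = subst₂ _<_ (sym (*-distribʳ-∸ b a q))
      (trans (cong (_∸ p * a) (*-comm a b)) (sym (*-distribʳ-∸ a b p)))
      (∸-monoʳ-< lt (*-monoˡ-≤ b (<⇒≤ q<a)))

    pa≢qb : ∀ {p q} → 0 < p → p < b → p * a ≢ q * b
    pa≢qb {p} {q} 0<p p<b pa≡qb = <⇒≱ p<b (∣⇒≤ {{>-nonZero 0<p}}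
      (Coprimality.coprime-divisor (Coprimality.sym a⊥b) (divides q (trans (*-comm a p) pa≡qb))))

    gapPair-flip : ∀ p q → 0 < p → p < b → 0 < q → q < a →
      𝟙 (gapPair? p q) + 𝟙 (gapPair? (b ∸ p) (a ∸ q)) ≡ 𝟙 (sameResidue? p q)
    gapPair-flip p q 0<p p<b 0<q q<a = by-residue (sameResidue? p q)
      where
      flipped⇒ : + ((b ∸ p) * a) ≡ + ((a ∸ q) * b) mod d → + (q * b) ≡ + (p * a) mod d
      flipped⇒ (congruent d∣) = congruent (subst (+ d ℤD.∣_) (flip-residue {p} {q} (<⇒≤ p<b) (<⇒≤ q<a)) d∣)
      flipped⇐ : + (q * b) ≡ + (p * a) mod d → + ((b ∸ p) * a) ≡ + ((a ∸ q) * b) mod d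
      flipped⇐ (congruent d∣) = congruent (subst (+ d ℤD.∣_) (sym (flip-residue {p} {q} (<⇒≤ p<b) (<⇒≤ q<a))) d∣)
      -- A `with` on sameResidue? p q would also abstract it inside the unfolded gapPair? p q.
      by-residue : (r : Dec (+ (p * a) ≡ + (q * b) mod d)) →
        𝟙 (gapPair? p q) + 𝟙 (gapPair? (b ∸ p) (a ∸ q)) ≡ 𝟙 r
      by-residue (no pa≢qb-mod) = cong₂ _+_
        (𝟙-no (gapPair? p q) (λ pq → pa≢qb-mod (GapPair.pa≡qb pq)))
        (𝟙-no (gapPair? (b ∸ p) (a ∸ q)) (λ pq′ → pa≢qb-mod (mod-sym (flipped⇒ (GapPair.pa≡qb pq′)))))
      by-residue (yes pa≡qb) with <-cmp (q * b) (p * a)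
      ... | tri< qb<pa _ _ = cong₂ _+_
        (𝟙-yes (gapPair? p q) (gapPair 0<q qb<pa pa≡qb))
        (𝟙-no (gapPair? (b ∸ p) (a ∸ q)) (λ pq′ → <-asym qb<pa (flip-< {p} {q} p<b q<a (GapPair.qb<pa pq′))))
      ... | tri≈ _ qb≡pa _ = ⊥-elim (pa≢qb {p} {q} 0<p p<b (sym qb≡pa))
      ... | tri> _ _ pa<qb = cong₂ _+_
        (𝟙-no (gapPair? p q) (λ pq → <-asym pa<qb (GapPair.qb<pa pq)))
        (𝟙-yes (gapPair? (b ∸ p) (a ∸ q))
          (gapPair (m<n⇒0<n∸m q<a) (flip-<⁻ {p} {q} p<b q<a pa<qb) (flipped⇐ (mod-sym pa≡qb))))

    A₁ B₁ : ℕ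
    A₁ = a ∸ 1
    B₁ = b ∸ 1

    1+A₁≡a : suc A₁ ≡ a
    1+A₁≡a = m+[n∸m]≡n (>-nonZero⁻¹ a)

    1+B₁≡b : suc B₁ ≡ b
    1+B₁≡b = m+[n∸m]≡n (>-nonZero⁻¹ b)

    row : ℕ → ℕ
    row p = ∑[ q < a ] 𝟙 (gapPair? p q)

    row-positive : ∀ p → row p ≡ ∑[ j < A₁ ] 𝟙 (gapPair? p (suc j))
    row-positive p = begin
      ∑[ q < a ] 𝟙 (gapPair? p q)                             ≡⟨ cong (λ n → ∑[ q < n ] 𝟙 (gapPair? p q)) 1+A₁≡a ⟨
      ∑[ q < suc A₁ ] 𝟙 (gapPair? p q)                        ≡⟨ ∑-suc A₁ (λ q → 𝟙 (gapPair? p q)) ⟩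
      𝟙 (gapPair? p 0) + ∑[ j < A₁ ] 𝟙 (gapPair? p (suc j))   ≡⟨ cong (_+ ∑[ j < A₁ ] 𝟙 (gapPair? p (suc j))) no-gap-at-0 ⟩
      ∑[ j < A₁ ] 𝟙 (gapPair? p (suc j))                      ∎
      where
      open ≡-Reasoning
      no-gap-at-0 : 𝟙 (gapPair? p 0) ≡ 0
      no-gap-at-0 = 𝟙-no (gapPair? p 0) (λ pq → <-irrefl refl (GapPair.0<q pq))

    row-zero : row 0 ≡ 0
    row-zero = trans (∑-cong a (λ q _ → 𝟙-no (gapPair? 0 q) (λ pq → n≮0 (GapPair.qb<pa pq))))
                     (trans (∑-const a 0) (*-zeroʳ a))

    row-pair : ∀ p → 0 < p → p < b → row p + row (b ∸ p) ≡ ∑[ j < A₁ ] 𝟙 (sameResidue? p (suc j))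
    row-pair p 0<p p<b = begin
      row p + row (b ∸ p)
        ≡⟨ cong₂ _+_ (row-positive p) (trans (row-positive (b ∸ p)) (∑-reverse A₁ _)) ⟩
      ∑[ j < A₁ ] 𝟙 (gapPair? p (suc j)) + ∑[ j < A₁ ] 𝟙 (gapPair? (b ∸ p) (suc (A₁ ∸ suc j)))
        ≡⟨ ∑-distrib-+ A₁ _ _ ⟨
      ∑[ j < A₁ ] (𝟙 (gapPair? p (suc j)) + 𝟙 (gapPair? (b ∸ p) (suc (A₁ ∸ suc j))))
        ≡⟨ ∑-cong A₁ (λ j j<A₁ → trans
             (cong (λ q → 𝟙 (gapPair? p (suc j)) + 𝟙 (gapPair? (b ∸ p) q))
                   (trans (sym (+-∸-assoc 1 j<A₁)) (cong (_∸ suc j) 1+A₁≡a)))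
             (gapPair-flip p (suc j) 0<p p<b z<s (subst (suc j <_) 1+A₁≡a (s≤s j<A₁)))) ⟩
      ∑[ j < A₁ ] 𝟙 (sameResidue? p (suc j))
        ∎
      where open ≡-Reasoning

    residuePairs : ℕ
    residuePairs = ∑[ i < B₁ ] ∑[ j < A₁ ] 𝟙 (sameResidue? (suc i) (suc j))

    genus+genus≡residuePairs : genus + genus ≡ residuePairs
    genus+genus≡residuePairs = begin
      genus + genus
        ≡⟨ cong₂ _+_ genus≡ (trans genus≡ (∑-reverse B₁ _)) ⟩
      ∑[ i < B₁ ] row (suc i) + ∑[ i < B₁ ] row (suc (B₁ ∸ suc i))
        ≡⟨ ∑-distrib-+ B₁ _ _ ⟨
      ∑[ i < B₁ ] (row (suc i) + row (suc (B₁ ∸ suc i)))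
        ≡⟨ ∑-cong B₁ (λ i i<B₁ → trans
             (cong (λ p → row (suc i) + row p) (trans (sym (+-∸-assoc 1 i<B₁)) (cong (_∸ suc i) 1+B₁≡b)))
             (row-pair (suc i) z<s (subst (suc i <_) 1+B₁≡b (s≤s i<B₁)))) ⟩
      residuePairs ∎
      where
      open ≡-Reasoning
      genus≡ : genus ≡ ∑[ i < B₁ ] row (suc i)
      genus≡ = begin
        ∑[ p < b ] row p                       ≡⟨ cong (λ n → ∑[ p < n ] row p) 1+B₁≡b ⟨
        ∑[ p < suc B₁ ] row p                  ≡⟨ ∑-suc B₁ row ⟩
        row 0 + ∑[ i < B₁ ] row (suc i)        ≡⟨ cong (_+ ∑[ i < B₁ ] row (suc i)) row-zero ⟩
        ∑[ i < B₁ ] row (suc i)                ∎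

    -- In the paper's notation ν is ν, c k / d is {k α}, and β / d is β.
    c : ℕ → ℕ
    c q = (q * m) % d

    ν β : ℕ
    ν = A₁ % d
    β = B₁ % d

    0%d≡0 : 0 % d ≡ 0
    0%d≡0 = m*n%n≡0 0 d

    qb≡a[qm] : ∀ q → + (q * b) ≡ + a ℤ.* + (q * m) mod d
    qb≡a[qm] q = begin
      + (q * b)                  ≡⟨ ℤ.pos-* q b ⟩
      + q ℤ.* + b                ≈⟨ mod-*ˡ (+ q) (mod-sym am≡b) ⟩
      + q ℤ.* (+ a ℤ.* + m)      ≡⟨ ℤ.*-assoc (+ q) (+ a) (+ m) ⟨
      + q ℤ.* + a ℤ.* + m        ≡⟨ cong (ℤ._* + m) (ℤ.*-comm (+ q) (+ a)) ⟩
      + a ℤ.* + q ℤ.* + m        ≡⟨ ℤ.*-assoc (+ a) (+ q) (+ m) ⟩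
      + a ℤ.* (+ q ℤ.* + m)      ≡⟨ cong (+ a ℤ.*_) (ℤ.pos-* q m) ⟨
      + a ℤ.* + (q * m)          ∎
      where open import Relation.Binary.Reasoning.Setoid (mod-setoid d)

    sameResidue⇒ : ∀ {p q} → + (p * a) ≡ + (q * b) mod d → p % d ≡ c q
    sameResidue⇒ {p} {q} pa≡qb = mod⇒%≡ (mod-cancelˡ a (Coprimality.sym a⊥d)
      (mod-trans (mod-reflexive (sym (+[m*n]≡+n*+m p a))) (mod-trans pa≡qb (qb≡a[qm] q))))

    sameResidue⇐ : ∀ {p q} → p % d ≡ c q → + (p * a) ≡ + (q * b) mod d
    sameResidue⇐ {p} {q} p≡c = mod-trans (mod-reflexive (+[m*n]≡+n*+m p a))
      (mod-trans (mod-*ˡ (+ a) (%≡⇒mod p≡c)) (mod-sym (qb≡a[qm] q)))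

    *m-cong : ∀ {x y} → + x ≡ + y mod d → + (x * m) ≡ + (y * m) mod d
    *m-cong {x} {y} x≡y = begin
      + (x * m)       ≡⟨ ℤ.pos-* x m ⟩
      + x ℤ.* + m     ≈⟨ mod-*ʳ (+ m) x≡y ⟩
      + y ℤ.* + m     ≡⟨ ℤ.pos-* y m ⟨
      + (y * m)       ∎
      where open import Relation.Binary.Reasoning.Setoid (mod-setoid d)

    *m-cancel : ∀ {x y} → + (x * m) ≡ + (y * m) mod d → + x ≡ + y mod d
    *m-cancel {x} {y} xm≡ym = mod-cancelˡ b (Coprimality.sym b⊥d) (begin
      + b ℤ.* + x       ≡⟨ +[m*n]≡+n*+m x b ⟨
      + (x * b)         ≈⟨ qb≡a[qm] x ⟩
      + a ℤ.* + (x * m) ≈⟨ mod-*ˡ (+ a) xm≡ym ⟩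
      + a ℤ.* + (y * m) ≈⟨ mod-sym (qb≡a[qm] y) ⟩
      + (y * b)         ≡⟨ +[m*n]≡+n*+m y b ⟩
      + b ℤ.* + y       ∎)
      where open import Relation.Binary.Reasoning.Setoid (mod-setoid d)

    0≡c⇒d∣ : ∀ q → 0 % d ≡ c q → q % d ≡ 0
    0≡c⇒d∣ q 0≡c = trans (mod⇒%≡ (*m-cancel {q} {0} (%≡⇒mod (sym 0≡c)))) 0%d≡0

    d∣⇒0≡c : ∀ q → q % d ≡ 0 → 0 % d ≡ c q
    d∣⇒0≡c q q%d≡0 = sym (mod⇒%≡ (*m-cong {q} {0} (%≡⇒mod (trans q%d≡0 (sym 0%d≡0)))))

    column-count : ∀ q → ∑[ i < B₁ ] 𝟙 (sameResidue? (suc i) q) + 𝟙 (0 % d ≟ c q) ≡ B₁ / d + 𝟙 (c q ≤? β)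
    column-count q = begin
      ∑[ i < B₁ ] 𝟙 (sameResidue? (suc i) q) + 𝟙 (0 % d ≟ c q)
        ≡⟨ +-comm _ (𝟙 (0 % d ≟ c q)) ⟩
      𝟙 (0 % d ≟ c q) + ∑[ i < B₁ ] 𝟙 (sameResidue? (suc i) q)
        ≡⟨ cong (_+_ (𝟙 (0 % d ≟ c q))) (∑-cong B₁ (λ i _ →
             𝟙-cong (sameResidue? (suc i) q) (suc i % d ≟ c q) (sameResidue⇒ {suc i} {q}) (sameResidue⇐ {suc i} {q}))) ⟩
      𝟙 (0 % d ≟ c q) + ∑[ i < B₁ ] 𝟙 (suc i % d ≟ c q)
        ≡⟨ ∑-suc B₁ (λ p → 𝟙 (p % d ≟ c q)) ⟨
      ∑[ p < suc B₁ ] 𝟙 (p % d ≟ c q)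
        ≡⟨ ∑𝟙-%≡ d (c q) B₁ (m%n<n (q * m) d) ⟩
      B₁ / d + 𝟙 (c q ≤? β) ∎
      where open ≡-Reasoning

    X Y : ℕ
    X = A₁ / d
    Y = B₁ / d

    Ĉ : ℕ
    Ĉ = ∑[ k < suc ν ] 𝟙 (c k ≤? β)

    multiples-of-d : ∑[ j < A₁ ] 𝟙 (0 % d ≟ c (suc j)) ≡ X
    multiples-of-d = +-cancelˡ-≡ 1 _ _ (begin
      1 + ∑[ j < A₁ ] 𝟙 (0 % d ≟ c (suc j))
        ≡⟨ cong₂ _+_ (sym (𝟙-yes (0 % d ≟ 0) 0%d≡0))
                     (∑-cong A₁ (λ j _ → 𝟙-cong (0 % d ≟ c (suc j)) (suc j % d ≟ 0) (0≡c⇒d∣ (suc j)) (d∣⇒0≡c (suc j)))) ⟩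
      𝟙 (0 % d ≟ 0) + ∑[ j < A₁ ] 𝟙 (suc j % d ≟ 0)
        ≡⟨ ∑-suc A₁ (λ q → 𝟙 (q % d ≟ 0)) ⟨
      ∑[ q < suc A₁ ] 𝟙 (q % d ≟ 0)
        ≡⟨ ∑𝟙-%≡ d 0 A₁ (>-nonZero⁻¹ d) ⟩
      X + 𝟙 (0 ≤? ν)
        ≡⟨ cong (_+_ X) (𝟙-yes (0 ≤? ν) z≤n) ⟩
      X + 1
        ≡⟨ +-comm X 1 ⟩
      1 + X ∎)
      where open ≡-Reasoning

    residuePairs-count : residuePairs + X ≡ A₁ * Y + ∑[ j < A₁ ] 𝟙 (c (suc j) ≤? β)
    residuePairs-count = begin
      residuePairs + X
        ≡⟨ cong₂ _+_ (∑-comm B₁ A₁ (λ i j → 𝟙 (sameResidue? (suc i) (suc j)))) (sym multiples-of-d) ⟩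
      ∑[ j < A₁ ] ∑[ i < B₁ ] 𝟙 (sameResidue? (suc i) (suc j)) + ∑[ j < A₁ ] 𝟙 (0 % d ≟ c (suc j))
        ≡⟨ ∑-distrib-+ A₁ _ _ ⟨
      ∑[ j < A₁ ] (∑[ i < B₁ ] 𝟙 (sameResidue? (suc i) (suc j)) + 𝟙 (0 % d ≟ c (suc j)))
        ≡⟨ ∑-cong A₁ (λ j _ → column-count (suc j)) ⟩
      ∑[ j < A₁ ] (Y + 𝟙 (c (suc j) ≤? β))
        ≡⟨ ∑-distrib-+ A₁ _ _ ⟩
      ∑[ _ < A₁ ] Y + ∑[ j < A₁ ] 𝟙 (c (suc j) ≤? β)
        ≡⟨ cong (_+ ∑[ j < A₁ ] 𝟙 (c (suc j) ≤? β)) (∑-const A₁ Y) ⟩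
      A₁ * Y + ∑[ j < A₁ ] 𝟙 (c (suc j) ≤? β) ∎
      where open ≡-Reasoning

    c-period : ∑[ x < d ] 𝟙 (c x ≤? β) ≡ suc β
    c-period = trans (∑𝟙-bijection (_≤? β) (λ x → c x ≤? β) d d c into injective onto)
                     (trans (∑𝟙-≤ β d) (m≥n⇒m⊓n≡n (m%n<n B₁ d)))
      where
      into : ∀ x → x < d → c x ≤ β → c x < d × c x ≤ β
      into x _ cx≤β = m%n<n (x * m) d , cx≤β
      injective : ∀ {x y} → x < d → y < d → c x ≤ β → c y ≤ β → c x ≡ c y → x ≡ y
      injective {x} {y} x<d y<d _ _ cx≡cy = mod-<-injective x<d y<d (*m-cancel {x} {y} (%≡⇒mod cx≡cy))
      b⁻¹ = proj₁ (mod-inverse b⊥d)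
      preimage : ℕ → ℕ
      preimage z = (+ z ℤ.* + a ℤ.* b⁻¹) %ℕ d
      c∘preimage : ∀ z → z < d → c (preimage z) ≡ z
      c∘preimage z z<d = trans (mod⇒%≡ xm≡z) (m<n⇒m%n≡m z<d)
        where
        open +-*-Solver
        open import Relation.Binary.Reasoning.Setoid (mod-setoid d)
        xm≡z : + (preimage z * m) ≡ + z mod d
        xm≡z = begin
          + (preimage z * m)                 ≡⟨ ℤ.pos-* (preimage z) m ⟩
          + preimage z ℤ.* + m               ≈⟨ mod-*ʳ (+ m) (mod-sym (mod-%ℕ (+ z ℤ.* + a ℤ.* b⁻¹) d)) ⟩
          + z ℤ.* + a ℤ.* b⁻¹ ℤ.* + m        ≡⟨ solve 4 (λ z a w m → z :* a :* w :* m := z :* w :* (a :* m)) refl (+ z) (+ a) b⁻¹ (+ m) ⟩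
          + z ℤ.* b⁻¹ ℤ.* (+ a ℤ.* + m)      ≈⟨ mod-*ˡ (+ z ℤ.* b⁻¹) am≡b ⟩
          + z ℤ.* b⁻¹ ℤ.* + b                ≡⟨ ℤ.*-assoc (+ z) b⁻¹ (+ b) ⟩
          + z ℤ.* (b⁻¹ ℤ.* + b)              ≈⟨ mod-*ˡ (+ z) (proj₂ (mod-inverse b⊥d)) ⟩
          + z ℤ.* + 1                        ≡⟨ ℤ.*-identityʳ (+ z) ⟩
          + z                                ∎
      onto : ∀ z → z < d → z ≤ β → ∃ λ x → x < d × c x ≤ β × c x ≡ z
      onto z z<d z≤β = preimage z , n%ℕd<d (+ z ℤ.* + a ℤ.* b⁻¹) d ,
                       subst (_≤ β) (sym (c∘preimage z z<d)) z≤β , c∘preimage z z<d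

    c-periodic : ∀ x → 𝟙 (c x ≤? β) ≡ 𝟙 (c (x % d) ≤? β)
    c-periodic x = 𝟙-cong (c x ≤? β) (c (x % d) ≤? β) (subst (_≤ β) cx≡) (subst (_≤ β) (sym cx≡))
      where
      cx≡ : c x ≡ c (x % d)
      cx≡ = mod⇒%≡ (*m-cong {x} {x % d} (mod-%ℕ (+ x) d))

    low-residues : 1 + ∑[ j < A₁ ] 𝟙 (c (suc j) ≤? β) ≡ X * suc β + Ĉ
    low-residues = begin
      1 + ∑[ j < A₁ ] 𝟙 (c (suc j) ≤? β)
        ≡⟨ cong (_+ ∑[ j < A₁ ] 𝟙 (c (suc j) ≤? β)) (sym (𝟙-yes (c 0 ≤? β) (subst (_≤ β) (sym 0%d≡0) z≤n))) ⟩
      𝟙 (c 0 ≤? β) + ∑[ j < A₁ ] 𝟙 (c (suc j) ≤? β)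
        ≡⟨ ∑-suc A₁ (λ x → 𝟙 (c x ≤? β)) ⟨
      ∑[ x < suc A₁ ] 𝟙 (c x ≤? β)
        ≡⟨ ∑-cong (suc A₁) (λ x _ → c-periodic x) ⟩
      ∑[ x < suc A₁ ] 𝟙 (c (x % d) ≤? β)
        ≡⟨ cong (λ n → ∑[ x < n ] 𝟙 (c (x % d) ≤? β)) 1+A₁≡ ⟩
      ∑[ x < X * d + suc ν ] 𝟙 (c (x % d) ≤? β)
        ≡⟨ ∑-periodic d (λ x → 𝟙 (c x ≤? β)) X (suc ν) (m%n<n A₁ d) ⟩
      X * ∑[ x < d ] 𝟙 (c x ≤? β) + Ĉ
        ≡⟨ cong (λ n → X * n + Ĉ) c-period ⟩
      X * suc β + Ĉ ∎
      where
      open ≡-Reasoning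
      1+A₁≡ : suc A₁ ≡ X * d + suc ν
      1+A₁≡ = trans (cong suc (trans (m≡m%n+[m/n]*n A₁ d) (+-comm ν (X * d)))) (sym (+-suc (X * d) ν))

    genus-identity : d * (genus + genus) + d + ν * β ≡ A₁ * B₁ + d * Ĉ
    genus-identity = begin
      d * (genus + genus) + d + ν * β     ≡⟨ cong (λ g → d * g + d + ν * β) genus+genus≡residuePairs ⟩
      d * residuePairs + d + ν * β        ≡⟨ multiply-out residuePairs counted ⟩
      (ν + X * d) * (β + Y * d) + d * Ĉ   ≡⟨ cong₂ (λ u v → u * v + d * Ĉ) (m≡m%n+[m/n]*n A₁ d) (m≡m%n+[m/n]*n B₁ d) ⟨
      A₁ * B₁ + d * Ĉ                     ∎
      where
      open ≡-Reasoning
      T = ∑[ j < A₁ ] 𝟙 (c (suc j) ≤? β)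
      counted : residuePairs + X + 1 ≡ (ν + X * d) * Y + (X * suc β + Ĉ)
      counted = begin
        residuePairs + X + 1        ≡⟨ cong (_+ 1) residuePairs-count ⟩
        A₁ * Y + T + 1              ≡⟨ +-assoc (A₁ * Y) T 1 ⟩
        A₁ * Y + (T + 1)            ≡⟨ cong₂ (λ u v → u * Y + v) (m≡m%n+[m/n]*n A₁ d) (trans (+-comm T 1) low-residues) ⟩
        (ν + X * d) * Y + (X * suc β + Ĉ) ∎
      multiply-out : ∀ R → R + X + 1 ≡ (ν + X * d) * Y + (X * suc β + Ĉ) →
        d * R + d + ν * β ≡ (ν + X * d) * (β + Y * d) + d * Ĉ
      multiply-out R e = +-cancelʳ-≡ (d * X) _ _ (begin
        d * R + d + ν * β + d * X                                   ≡⟨ lhs d R X ν β ⟩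
        d * (R + X + 1) + ν * β                                     ≡⟨ cong (λ z → d * z + ν * β) e ⟩
        d * ((ν + X * d) * Y + (X * suc β + Ĉ)) + ν * β             ≡⟨ rhs d X Y ν β Ĉ ⟩
        (ν + X * d) * (β + Y * d) + d * Ĉ + d * X                   ∎)
        where
        open ℕ-Solver
        lhs : ∀ d R X ν β → d * R + d + ν * β + d * X ≡ d * (R + X + 1) + ν * β
        lhs = solve 5 (λ d R X ν β → d :* R :+ d :+ ν :* β :+ d :* X := d :* (R :+ X :+ con 1) :+ ν :* β) refl
        rhs : ∀ d X Y ν β Ĉ → d * ((ν + X * d) * Y + (X * suc β + Ĉ)) + ν * β ≡ (ν + X * d) * (β + Y * d) + d * Ĉ + d * X
        rhs = solve 6 (λ d X Y ν β Ĉ → d :* ((ν :+ X :* d) :* Y :+ (X :* (con 1 :+ β) :+ Ĉ)) :+ ν :* β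
                                       := (ν :+ X :* d) :* (β :+ Y :* d) :+ d :* Ĉ :+ d :* X) refl

    Ĉ≡1 : ν ≡ 0 ⊎ β ≡ 0 → Ĉ ≡ 1
    Ĉ≡1 (inj₁ ν≡0) = trans (cong (λ n → ∑[ k < suc n ] 𝟙 (c k ≤? β)) ν≡0) (𝟙-yes (c 0 ≤? β) (subst (_≤ β) (sym 0%d≡0) z≤n))
    Ĉ≡1 (inj₂ β≡0) = begin
      ∑[ k < suc ν ] 𝟙 (c k ≤? β)       ≡⟨ ∑-cong (suc ν) (λ k _ → 𝟙-cong (c k ≤? β) (k % d ≟ 0) (c≤β⇒ k) (⇒c≤β k)) ⟩
      ∑[ k < suc ν ] 𝟙 (k % d ≟ 0)      ≡⟨ ∑𝟙-%≡ d 0 ν (>-nonZero⁻¹ d) ⟩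
      ν / d + 𝟙 (0 ≤? ν % d)            ≡⟨ cong₂ _+_ (m<n⇒m/n≡0 (m%n<n A₁ d)) (𝟙-yes (0 ≤? ν % d) z≤n) ⟩
      1                                 ∎
      where
      open ≡-Reasoning
      c≤β⇒ : ∀ k → c k ≤ β → k % d ≡ 0
      c≤β⇒ k ck≤β = 0≡c⇒d∣ k (trans 0%d≡0 (sym (n≤0⇒n≡0 (subst (c k ≤_) β≡0 ck≤β))))
      ⇒c≤β : ∀ k → k % d ≡ 0 → c k ≤ β
      ⇒c≤β k k%d≡0 = ≤-reflexive (trans (sym (d∣⇒0≡c k k%d≡0)) (trans 0%d≡0 (sym β≡0)))

    genus-identity-degenerate : ν ≡ 0 ⊎ β ≡ 0 → d * (genus + genus) ≡ A₁ * B₁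
    genus-identity-degenerate νβ≡0 = +-cancelʳ-≡ d _ _ (begin
      d * (genus + genus) + d             ≡⟨ +-identityʳ _ ⟨
      d * (genus + genus) + d + 0         ≡⟨ cong (_+_ (d * (genus + genus) + d)) (sym (ν*β≡0 νβ≡0)) ⟩
      d * (genus + genus) + d + ν * β     ≡⟨ genus-identity ⟩
      A₁ * B₁ + d * Ĉ                     ≡⟨ cong (λ z → A₁ * B₁ + d * z) (Ĉ≡1 νβ≡0) ⟩
      A₁ * B₁ + d * 1                     ≡⟨ cong (_+_ (A₁ * B₁)) (*-identityʳ d) ⟩
      A₁ * B₁ + d                         ∎)
      where
      open ≡-Reasoning
      ν*β≡0 : ν ≡ 0 ⊎ β ≡ 0 → ν * β ≡ 0
      ν*β≡0 (inj₁ ν≡0) = cong (_* β) ν≡0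
      ν*β≡0 (inj₂ β≡0) = trans (cong (ν *_) β≡0) (*-zeroʳ ν)

open import Defs
open import Data.Nat as ℕ using (ℕ; _<_; _∸_; NonZero)
open import Data.Nat.Divisibility using (_∣_)
open import Data.Nat.Coprimality using (Coprime)
open import Data.Integer as ℤ using (ℤ; +_)
open import Data.Integer.Divisibility as ℤD using ()
open import Data.Rational as ℚ using (ℚ; _/_; _+_; _-_; _*_; ½; 1ℚ)
open import Data.Product using (∃; _×_)
open import Data.Sum using (_⊎_)
open import Relation.Binary.PropositionalEquality using (_≡_)

open FiniteSums
open IntegerCongruence
open RationalArithmetic
open NumericalSemigroupGaps
open GapCount
import Data.Nat.Properties as ℕ
import Data.Nat.DivMod as ℕ
import Data.Nat.Divisibility as ℕ
import Data.Nat.Coprimality as Coprimality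
import Data.Rational.Properties as ℚ
open import Data.Integer.DivMod using (_%ℕ_)
open import Data.Integer.Divisibility.Signed using (∣ᵤ⇒∣)
open import Data.Product using (_,_)
open import Data.Sum using (inj₁; inj₂)
open import Function.Bundles using (mk⇔)
open import Relation.Binary.PropositionalEquality using (sym; trans; cong; subst; subst₂; module ≡-Reasoning)

module Sylvester (a b : ℕ) .{{_ : NonZero a}} .{{_ : NonZero b}} (a⊥b : Coprime a b) where

  open GenusFormula a b 1 a⊥b (Coprimality.sym (Coprimality.1-coprimeTo a))
    (Coprimality.sym (Coprimality.1-coprimeTo b)) 0 (mod-1 _ _)
    using (genus; isGenus-genus; genus-identity-degenerate)

  isGenus-⟨a,b⟩ : IsGenus ⟨ a , b ⟩ genus
  isGenus-⟨a,b⟩ = isGenus-resp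
    (λ n → mk⇔ (subst ⟨ a , b ⟩ (ℕ.*-identityˡ n)) (subst ⟨ a , b ⟩ (sym (ℕ.*-identityˡ n))))
    isGenus-genus

  sylvester : ∀ {g} → IsGenus ⟨ a , b ⟩ g → g ℕ.+ g ≡ (a ∸ 1) ℕ.* (b ∸ 1)
  sylvester isGenus-g = trans (cong (λ g → g ℕ.+ g) (isGenus-unique isGenus-g isGenus-⟨a,b⟩))
    (trans (sym (ℕ.*-identityˡ _)) (genus-identity-degenerate (inj₁ (ℕ.n%1≡0 (a ∸ 1)))))

aμ%d≡b : ∀ {a b d} .{{_ : NonZero d}} (μ : ℤ) → + d ℤD.∣ (+ b ℤ.- + a ℤ.* μ) → + a ℤ.* + (μ %ℕ d) ≡ + b mod d
aμ%d≡b {a} {d = d} μ d∣b-aμ = mod-trans (mod-*ˡ (+ a) (mod-sym (mod-%ℕ μ d))) (mod-sym (congruent (∣ᵤ⇒∣ d∣b-aμ)))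

module QuotientGenus (a b d : ℕ) .{{_ : NonZero a}} .{{_ : NonZero b}} .{{_ : NonZero d}}
  (a⊥b : Coprime a b) (a⊥d : Coprime a d) (b⊥d : Coprime b d)
  (μ : ℤ) (d∣b-aμ : + d ℤD.∣ (+ b ℤ.- + a ℤ.* μ)) where

  open Sylvester a b a⊥b public using (isGenus-⟨a,b⟩; sylvester)
  open GenusFormula a b d a⊥b a⊥d b⊥d (μ %ℕ d) (aμ%d≡b {a} {b} {d} μ d∣b-aμ) public
    using (genus; isGenus-genus; ν; β; Ĉ; c; genus-identity; genus-identity-degenerate)

  α βℚ : ℚ
  α = frac (μ / d)
  βℚ = frac (+ (b ∸ 1) / d)

  βℚ≡ : βℚ ≡ + β / d
  βℚ≡ = frac-/ (+ (b ∸ 1)) d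

  C≡Ĉ : C α βℚ ν ≡ Ĉ
  C≡Ĉ = trans (length-filter-upTo (λ k → frac (fromℕ k * α) ℚ.≤? βℚ) (ℕ.suc ν))
    (∑-cong (ℕ.suc ν) (λ k _ → 𝟙-cong (frac (fromℕ k * α) ℚ.≤? βℚ) (c k ℕ.≤? β)
      (λ ≤βℚ → /-cancel-≤ (c k) β d (subst₂ ℚ._≤_ (frac-*-frac k μ d) βℚ≡ ≤βℚ))
      (λ ≤β → subst₂ ℚ._≤_ (sym (frac-*-frac k μ d)) (sym βℚ≡) (/-mono-≤ (c k) β d ≤β))))

  genus-formula : ∀ {g₁ g₂} → IsGenus ⟨ a , b ⟩ g₁ → IsGenus (⟨ a , b ⟩ /ˢ d) g₂ →
    fromℕ g₂ ≡ + g₁ / d + ½ * (fromℕ (C α βℚ ν) - 1ℚ - βℚ * fromℕ ν)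
  genus-formula {g₁} {g₂} isGenus-g₁ isGenus-g₂ =
    subst₂ (λ C′ β′ → fromℕ g₂ ≡ + g₁ / d + ½ * (fromℕ C′ - 1ℚ - β′ * fromℕ ν))
    (sym C≡Ĉ) (sym βℚ≡) (halve-identity g₁ g₂ Ĉ ν β d identity)
    where
    identity : d ℕ.* (g₂ ℕ.+ g₂) ℕ.+ d ℕ.+ ν ℕ.* β ≡ (g₁ ℕ.+ g₁) ℕ.+ d ℕ.* Ĉ
    identity = subst₂ (λ g G → d ℕ.* (g ℕ.+ g) ℕ.+ d ℕ.+ ν ℕ.* β ≡ G ℕ.+ d ℕ.* Ĉ)
      (isGenus-unique isGenus-genus isGenus-g₂) (sym (sylvester isGenus-g₁)) genus-identity

  genus-formula-degenerate : ∀ {g₁ g₂} → IsGenus ⟨ a , b ⟩ g₁ → IsGenus (⟨ a , b ⟩ /ˢ d) g₂ →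
    d ∣ a ∸ 1 ⊎ d ∣ b ∸ 1 → d ℕ.* g₂ ≡ g₁
  genus-formula-degenerate {g₁} {g₂} isGenus-g₁ isGenus-g₂ d∣ = double-injective (begin
    d ℕ.* g₂ ℕ.+ d ℕ.* g₂       ≡⟨ ℕ.*-distribˡ-+ d g₂ g₂ ⟨
    d ℕ.* (g₂ ℕ.+ g₂)           ≡⟨ cong (λ g → d ℕ.* (g ℕ.+ g)) (isGenus-unique isGenus-g₂ isGenus-genus) ⟩
    d ℕ.* (genus ℕ.+ genus)     ≡⟨ genus-identity-degenerate (ν≡0⊎β≡0 d∣) ⟩
    (a ∸ 1) ℕ.* (b ∸ 1)         ≡⟨ sylvester isGenus-g₁ ⟨
    g₁ ℕ.+ g₁                   ∎)
    where
    open ≡-Reasoning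
    double-injective : ∀ {x y} → x ℕ.+ x ≡ y ℕ.+ y → x ≡ y
    double-injective {x} {y} x+x≡y+y =
      trans (ℕ.n≡⌊n+n/2⌋ x) (trans (cong ℕ.⌊_/2⌋ x+x≡y+y) (sym (ℕ.n≡⌊n+n/2⌋ y)))
    ν≡0⊎β≡0 : d ∣ a ∸ 1 ⊎ d ∣ b ∸ 1 → ν ≡ 0 ⊎ β ≡ 0
    ν≡0⊎β≡0 (inj₁ d∣a-1) = inj₁ (ℕ.n∣m⇒m%n≡0 (a ∸ 1) d d∣a-1)
    ν≡0⊎β≡0 (inj₂ d∣b-1) = inj₂ (ℕ.n∣m⇒m%n≡0 (b ∸ 1) d d∣b-1)

theorem10 : (a b d : ℕ) → .{{_ : NonZero d}} → 0 < a → 0 < b →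
    Coprime a b → Coprime a d → Coprime b d →
    (m : ℤ) → (+ d) ℤD.∣ ((+ b) ℤ.- (+ a) ℤ.* m) →
    (ν : ℕ) → (+ ν / 1) ≡ (+ d / 1) * frac (+ (a ∸ 1) / d) →
    let α = frac (m / d)
        β = frac (+ (b ∸ 1) / d)
    in (∃ λ g₁ → IsGenus ⟨ a , b ⟩ g₁)
     × (∃ λ g₂ → IsGenus (⟨ a , b ⟩ /ˢ d) g₂)
     × (∀ g₁ g₂ → IsGenus ⟨ a , b ⟩ g₁ → IsGenus (⟨ a , b ⟩ /ˢ d) g₂ →
          ((+ g₂ / 1) ≡ (+ g₁ / d) + ½ * ((+ C α β ν / 1) - 1ℚ - β * (+ ν / 1)))
        × ((d ∣ a ∸ 1 ⊎ d ∣ b ∸ 1) →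
             ((+ g₂ / 1) ≡ (+ g₁ / d))
           × ((+ g₁ / d) ≡ (+ ((a ∸ 1) ℕ.* (b ∸ 1)) / d) * ½)))
theorem10 a b d 0<a 0<b a⊥b a⊥d b⊥d m d∣b-am ν ν≡d*frac =
  (_ , isGenus-⟨a,b⟩) , (_ , isGenus-genus) , λ g₁ g₂ isGenus-g₁ isGenus-g₂ →
    subst (λ n → fromℕ g₂ ≡ + g₁ / d + ½ * (fromℕ (C α βℚ n) - 1ℚ - βℚ * fromℕ n))
      (sym (*-frac-/ ν (a ∸ 1) d ν≡d*frac)) (genus-formula isGenus-g₁ isGenus-g₂)
    , λ d∣ → fromℕ≡/ g₁ g₂ d (genus-formula-degenerate isGenus-g₁ isGenus-g₂ d∣)
           , /≡/*½ g₁ _ d (sylvester isGenus-g₁)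
  where
  instance
    a≢0 : NonZero a
    a≢0 = ℕ.>-nonZero 0<a
    b≢0 : NonZero b
    b≢0 = ℕ.>-nonZero 0<b
  open QuotientGenus a b d a⊥b a⊥d b⊥d m d∣b-am
    using (isGenus-⟨a,b⟩; isGenus-genus; α; βℚ; genus-formula; genus-formula-degenerate; sylvester)
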